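{- Let $m=p_1p_2\cdots p_k$ be a primitive abundant number, where $p_1\le\dots\le p_k$ are primes (not necessarily distinct). Let $1\le j<k$ and let $\tilde p_j$ be a prime with $p_{j-1}<\tilde p_j<p_j$ (where $p_0:=1$) such that $p_1\cdots p_{j-1}\tilde p_j$ is deficient. Then there exist primes $\tilde p_{j+1}\le\dots\le\tilde p_k$ with $\tilde p_j\le\tilde p_{j+1}$ such that $\tilde m=p_1\cdots p_{j-1}\tilde p_j\tilde p_{j+1}\cdots\tilde p_k$ is abundant and $p_1\cdots p_{j-1}\tilde p_j\cdots\tilde p_i$ is deficient for every $i<k$ (with $i\ge j$).
   Context: For $n\in\mathbb{N}$, $\sigma(n)=\sum_{d\mid n}d$. $n$ is deficient if $\sigma(n)<2n$, perfect if $\sigma(n)=2n$, abundant if $\sigma(n)>2n$, and non-deficient if perfect or abundant. A primitive abundant number is an abundant number all of whose proper divisors are deficient. -}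

module Defs where

open import Data.Nat using (ℕ; suc; _+_; _*_; _<_; _≤_; _>_)
open import Data.Nat.Divisibility using (_∣_; _∣?_)
open import Data.List using (List; []; _∷_; filter; applyUpTo)
open import Data.Nat.ListAction using (sum; product)
open import Data.Product using (_×_)

-- σ(n) = sum of positive divisors of n (divisors of n lie in [1..n] for n ≥ 1; σ 0 = 0)
σ : ℕ → ℕ
σ n = sum (filter (_∣? n) (applyUpTo suc n))

Deficient : ℕ → Set
Deficient n = σ n < 2 * n

Abundant : ℕ → Set
Abundant n = σ n > 2 * n

PrimitiveAbundant : ℕ → Set
PrimitiveAbundant n = Abundant n × (∀ d → d ∣ n → d < n → Deficient d)

-- last element of a list, or 1 if empty (the convention p₀ := 1)
lastOr1 : List ℕ → ℕ
lastOr1 []           = 1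
lastOr1 (x ∷ [])     = x
lastOr1 (x ∷ y ∷ xs) = lastOr1 (y ∷ xs)

{-# OPTIONS --safe #-}
-- For a prime p ∤ u one has σ (u p) = σ u (p + 1), and σ (u p) ≤ σ u (p + 1) always. Hence replacing
-- p_j by the smaller prime q = p̃_j keeps the product abundant, so with N = p₁ ⋯ p_{j-1} q the number
-- N p_{j+1} ⋯ p_k is abundant. Now append p_{j+1}, p_{j+2}, … to N as long as the product stays
-- deficient. At the first prime r that would make it non-deficient, let t = 2N − σ N > 0 and pick
-- primes σN/t < a < b with a b < (σN/t)(1 + a + b): then N a is deficient, N a b is abundant, and
-- N a satisfies the starting condition with a in place of r, so repeating this fills any length.
-- Such prime pairs exist above every n ≥ 2: for n < 8192 by a table, and beyond from two primes in
-- (n, 2n], which Erdős' estimate of the central binomial coefficient provides.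
module Submission where

open import Defs
open import Data.Nat
  using ( ℕ; zero; suc; _+_; _*_; _∸_; _<_; _≤_; _^_; _!; _/_; _%_; z≤n; s≤s; _<?_; _≤?_
        ; NonZero; >-nonZero; >-nonZero⁻¹; n>1⇒nonTrivial; nonTrivial⇒n>1)
open import Data.Nat.Properties
open import Data.Nat.Divisibility
open import Data.Nat.DivMod
open import Data.Nat.Induction using (<-rec)
open import Data.Nat.Primality
open import Data.Nat.Primality.Factorisation using (PrimeFactorisation; factorise; factorisationHasAllPrimeFactors)
open import Data.Nat.Coprimality using (Coprime; coprime-divisor) renaming (sym to Coprime-sym)
open import Data.Nat.Combinatorics using (_C_; nCk≡n!/k![n-k]!; k![n∸k]!∣n!)
open import Data.Nat.ListAction using (sum; product)
open import Data.Nat.ListAction.Properties using (sum-++; product-++)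
open import Data.Nat.Tactic.RingSolver using (solve-∀)
open import Data.List using (List; []; _∷_; _++_; length; take; filter; applyUpTo; map; _∷ʳ_)
open import Data.List.Properties using (applyUpTo-∷ʳ; map-++; ++-assoc)
open import Data.List.Relation.Unary.All using (All; []; _∷_)
  renaming (map to All-map; lookup to All-lookup; head to All-head; tail to All-tail)
open import Data.List.Relation.Unary.All.Properties using (++⁺; ++⁻ˡ; ++⁻ʳ)
open import Data.List.Relation.Unary.Linked using (Linked; []; [-]; _∷_) renaming (map to Linked-map; tail to Linked-tail)
open import Data.List.Relation.Unary.Linked.Properties using (Linked⇒All)
open import Data.Bool using (if_then_else_)
open import Data.Empty using (⊥-elim)
open import Data.Unit using (⊤; tt)
open import Data.Product using (_×_; _,_; proj₁; ∃-syntax; map₂)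
open import Data.Sum using (_⊎_; inj₁; inj₂; [_,_]′)
open import Function using (_∘_)
open import Relation.Nullary using (¬_; Dec; yes; no; does; contradiction; _×-dec_)
open import Relation.Nullary.Decidable using (from-yes)
open import Relation.Unary using (Decidable)
open import Relation.Binary.PropositionalEquality

if-does-yes : ∀ {P : Set} (P? : Dec P) {a b : ℕ} → P → (if does P? then a else b) ≡ a
if-does-yes (yes _) _ = refl
if-does-yes (no ¬p) p = contradiction p ¬p

if-does-no : ∀ {P : Set} (P? : Dec P) {a b : ℕ} → ¬ P → (if does P? then a else b) ≡ b
if-does-no (yes p) ¬p = contradiction p ¬p
if-does-no (no _) _ = refl

prime≥2 : ∀ {p} → Prime p → 2 ≤ p
prime≥2 {p} pp = nonTrivial⇒n>1 p {{prime⇒nonTrivial pp}}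

prime>0 : ∀ {p} → Prime p → 0 < p
prime>0 pp = <-trans (s≤s z≤n) (prime≥2 pp)

prime∤1 : ∀ {p} → Prime p → ¬ p ∣ 1
prime∤1 pp p∣1 = contradiction (prime≥2 pp) (<⇒≱ (s≤s (≤-reflexive (∣1⇒≡1 p∣1))))

prime∣prime⇒≡ : ∀ {p q} → Prime p → Prime q → p ∣ q → p ≡ q
prime∣prime⇒≡ pp pq p∣q with prime⇒irreducible pq p∣q
... | inj₂ p≡q = p≡q
... | inj₁ refl = contradiction pp λ ()

prime∤⇒coprime : ∀ {p d} → Prime p → ¬ p ∣ d → Coprime d p
prime∤⇒coprime pp p∤d (i∣d , i∣p) with prime⇒irreducible pp i∣p
... | inj₁ i≡1 = i≡1
... | inj₂ refl = contradiction i∣d p∤d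

-- Finite sums and the divisor function

sumTo : (ℕ → ℕ) → ℕ → ℕ
sumTo f zero    = 0
sumTo f (suc n) = sumTo f n + f (suc n)

sumTo-cong : ∀ {f g} n → (∀ i → 1 ≤ i → i ≤ n → f i ≡ g i) → sumTo f n ≡ sumTo g n
sumTo-cong zero    _   = refl
sumTo-cong (suc n) f≡g =
  cong₂ _+_ (sumTo-cong n λ i 1≤i i≤n → f≡g i 1≤i (m≤n⇒m≤1+n i≤n)) (f≡g (suc n) (s≤s z≤n) ≤-refl)

sumTo-mono-≤ : ∀ {f g} n → (∀ i → f i ≤ g i) → sumTo f n ≤ sumTo g n
sumTo-mono-≤ zero    _   = z≤n
sumTo-mono-≤ (suc n) f≤g = +-mono-≤ (sumTo-mono-≤ n f≤g) (f≤g (suc n))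

sumTo-+ : ∀ f g n → sumTo (λ i → f i + g i) n ≡ sumTo f n + sumTo g n
sumTo-+ f g zero    = refl
sumTo-+ f g (suc n) = trans (cong (_+ (f (suc n) + g (suc n))) (sumTo-+ f g n)) (swap (sumTo f n) _ _ _)
  where
  swap : ∀ a b c d → a + b + (c + d) ≡ a + c + (b + d)
  swap = solve-∀

sumTo-*ˡ : ∀ c f n → sumTo (λ i → c * f i) n ≡ c * sumTo f n
sumTo-*ˡ c f zero    = sym (*-zeroʳ c)
sumTo-*ˡ c f (suc n) = trans (cong (_+ c * f (suc n)) (sumTo-*ˡ c f n)) (sym (*-distribˡ-+ c _ _))

sumTo-split : ∀ f a b → sumTo f (a + b) ≡ sumTo f a + sumTo (λ i → f (a + i)) b
sumTo-split f a zero    = trans (cong (sumTo f) (+-identityʳ a)) (sym (+-identityʳ _))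
sumTo-split f a (suc b) = begin
  sumTo f (a + suc b)                                  ≡⟨ cong (sumTo f) (+-suc a b) ⟩
  sumTo f (a + b) + f (suc (a + b))                    ≡⟨ cong₂ _+_ (sumTo-split f a b) (cong f (sym (+-suc a b))) ⟩
  sumTo f a + sumTo (λ i → f (a + i)) b + f (a + suc b) ≡⟨ +-assoc (sumTo f a) _ _ ⟩
  sumTo f a + sumTo (λ i → f (a + i)) (suc b)          ∎
  where open ≡-Reasoning

sumTo-zero : ∀ f n → (∀ i → 1 ≤ i → i ≤ n → f i ≡ 0) → sumTo f n ≡ 0
sumTo-zero f n f≡0 = trans (sumTo-cong n f≡0) (sumTo-const0 n)
  where
  sumTo-const0 : ∀ n → sumTo (λ _ → 0) n ≡ 0
  sumTo-const0 zero    = refl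
  sumTo-const0 (suc n) = trans (+-identityʳ _) (sumTo-const0 n)

sumTo-multiples : ∀ p .{{_ : NonZero p}} g M →
  sumTo (λ d → if does (p ∣? d) then g (d / p) else 0) (M * p) ≡ sumTo g M
sumTo-multiples p           g zero    = refl
sumTo-multiples p@(suc p-1) g (suc M) = begin
  sumTo F (p + M * p)                          ≡⟨ cong (sumTo F) (+-comm p (M * p)) ⟩
  sumTo F (M * p + p)                          ≡⟨ sumTo-split F (M * p) p ⟩
  sumTo F (M * p) + sumTo (λ i → F (M * p + i)) p ≡⟨ cong₂ _+_ (sumTo-multiples p g M) block ⟩
  sumTo g M + g (suc M)                        ∎
  where
  open ≡-Reasoning
  F : ℕ → ℕ
  F d = if does (p ∣? d) then g (d / p) else 0
  inner : ∀ i → 1 ≤ i → i ≤ p-1 → F (M * p + i) ≡ 0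
  inner i 1≤i i<p = if-does-no (p ∣? (M * p + i))
    λ p∣ → <⇒≱ (s≤s i<p) (∣⇒≤ {{>-nonZero 1≤i}} (∣m+n∣m⇒∣n p∣ (n∣m*n M)))
  last : F (M * p + p) ≡ g (suc M)
  last = trans (if-does-yes (p ∣? (M * p + p)) (∣m∣n⇒∣m+n (n∣m*n M) ∣-refl))
               (cong g (trans (cong (_/ p) (+-comm (M * p) p)) (m*n/n≡m (suc M) p)))
  block : sumTo (λ i → F (M * p + i)) p ≡ g (suc M)
  block = trans (cong (_+ F (M * p + p)) (sumTo-zero (λ i → F (M * p + i)) p-1 inner)) last

divisorTerm : ℕ → ℕ → ℕ
divisorTerm n d = if does (d ∣? n) then d else 0

divisorTerm-∣ : ∀ {n d} → d ∣ n → divisorTerm n d ≡ d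
divisorTerm-∣ {n} {d} = if-does-yes (d ∣? n)

divisorTerm-∤ : ∀ {n d} → ¬ d ∣ n → divisorTerm n d ≡ 0
divisorTerm-∤ {n} {d} = if-does-no (d ∣? n)

σ≡sumTo-divisorTerm : ∀ n → σ n ≡ sumTo (divisorTerm n) n
σ≡sumTo-divisorTerm n = trans (sum-filter (applyUpTo suc n)) (sum-map-applyUpTo n)
  where
  sum-filter : ∀ xs → sum (filter (_∣? n) xs) ≡ sum (map (divisorTerm n) xs)
  sum-filter []       = refl
  sum-filter (x ∷ xs) with x ∣? n
  ... | yes _ = cong (x +_) (sum-filter xs)
  ... | no  _ = sum-filter xs
  sum-map-applyUpTo : ∀ k → sum (map (divisorTerm n) (applyUpTo suc k)) ≡ sumTo (divisorTerm n) k
  sum-map-applyUpTo zero    = refl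
  sum-map-applyUpTo (suc k) = begin
    sum (map f (applyUpTo suc (suc k)))        ≡⟨ cong (λ l → sum (map f l)) (sym (applyUpTo-∷ʳ suc k)) ⟩
    sum (map f (applyUpTo suc k ∷ʳ suc k))     ≡⟨ cong sum (map-++ f (applyUpTo suc k) (suc k ∷ [])) ⟩
    sum (map f (applyUpTo suc k) ++ f (suc k) ∷ []) ≡⟨ sum-++ (map f (applyUpTo suc k)) (f (suc k) ∷ []) ⟩
    sum (map f (applyUpTo suc k)) + (f (suc k) + 0) ≡⟨ cong₂ _+_ (sum-map-applyUpTo k) (+-identityʳ _) ⟩
    sumTo f (suc k)                            ∎
    where
    open ≡-Reasoning
    f = divisorTerm n

module _ {p} (p-prime : Prime p) (u : ℕ) where
  private instance
    p≢0 : NonZero p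
    p≢0 = prime⇒nonZero p-prime

  multipleTerm : ℕ → ℕ
  multipleTerm d = if does (p ∣? d) then p * divisorTerm u (d / p) else 0

  divisorTerm-*-≤ : ∀ d → divisorTerm (u * p) d ≤ divisorTerm u d + multipleTerm d
  divisorTerm-*-≤ d with d ∣? (u * p)
  ... | no _     = z≤n
  ... | yes d∣up with p ∣? d
  ...   | yes p∣d = begin
    d                         ≡⟨ sym (m*[n/m]≡n p∣d) ⟩
    p * (d / p)               ≡⟨ cong (p *_) (sym (divisorTerm-∣ d/p∣u)) ⟩
    p * divisorTerm u (d / p) ≤⟨ m≤n+m _ _ ⟩
    divisorTerm u d + p * divisorTerm u (d / p) ∎
    where
    open ≤-Reasoning
    d/p∣u : d / p ∣ u
    d/p∣u = *-cancelˡ-∣ p (subst₂ _∣_ (sym (m*[n/m]≡n p∣d)) (*-comm u p) d∣up)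
  ...   | no p∤d = ≤-trans (≤-reflexive (sym (divisorTerm-∣ d∣u))) (m≤m+n _ _)
    where
    d∣u : d ∣ u
    d∣u = coprime-divisor (prime∤⇒coprime p-prime p∤d) (subst (d ∣_) (*-comm u p) d∣up)

  divisorTerm-*-≥ : ¬ p ∣ u → ∀ d → divisorTerm u d + multipleTerm d ≤ divisorTerm (u * p) d
  divisorTerm-*-≥ p∤u d with d ∣? u | p ∣? d
  ... | yes d∣u | yes p∣d = contradiction (∣-trans p∣d d∣u) p∤u
  ... | yes d∣u | no _    = ≤-reflexive (trans (+-identityʳ d) (sym (divisorTerm-∣ (∣-trans d∣u (m∣m*n p)))))
  ... | no _    | no _    = z≤n
  ... | no _    | yes p∣d with (d / p) ∣? u
  ...   | yes d/p∣u = ≤-reflexive (trans (m*[n/m]≡n p∣d) (sym (divisorTerm-∣ d∣up)))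
    where
    d∣up : d ∣ u * p
    d∣up = subst₂ _∣_ (m*[n/m]≡n p∣d) (*-comm p u) (*-monoʳ-∣ p d/p∣u)
  ...   | no _ = ≤-trans (≤-reflexive (*-zeroʳ p)) z≤n

  module _ (u>0 : 0 < u) where
    sumTo-divisorTerm : sumTo (divisorTerm u) (u * p) ≡ σ u
    sumTo-divisorTerm = begin
      sumTo (divisorTerm u) (u * p)                  ≡⟨ cong (sumTo (divisorTerm u)) (sym (m+[n∸m]≡n (m≤m*n u p))) ⟩
      sumTo (divisorTerm u) (u + (u * p ∸ u))        ≡⟨ sumTo-split (divisorTerm u) u (u * p ∸ u) ⟩
      sumTo (divisorTerm u) u + sumTo (λ i → divisorTerm u (u + i)) (u * p ∸ u)
                                                     ≡⟨ cong₂ _+_ (sym (σ≡sumTo-divisorTerm u)) (sumTo-zero _ _ beyond-u) ⟩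
      σ u + 0                                        ≡⟨ +-identityʳ _ ⟩
      σ u                                            ∎
      where
      open ≡-Reasoning
      beyond-u : ∀ i → 1 ≤ i → i ≤ u * p ∸ u → divisorTerm u (u + i) ≡ 0
      beyond-u i 1≤i _ = divisorTerm-∤ λ u+i∣u → <⇒≱ (m<m+n u 1≤i) (∣⇒≤ {{>-nonZero u>0}} u+i∣u)

    sumTo-multipleTerm : sumTo multipleTerm (u * p) ≡ p * σ u
    sumTo-multipleTerm = begin
      sumTo multipleTerm (u * p)               ≡⟨ sumTo-multiples p (λ e → p * divisorTerm u e) u ⟩
      sumTo (λ e → p * divisorTerm u e) u      ≡⟨ sumTo-*ˡ p (divisorTerm u) u ⟩
      p * sumTo (divisorTerm u) u              ≡⟨ cong (p *_) (sym (σ≡sumTo-divisorTerm u)) ⟩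
      p * σ u                                  ∎
      where open ≡-Reasoning

    sumTo-both-terms : sumTo (λ d → divisorTerm u d + multipleTerm d) (u * p) ≡ σ u * suc p
    sumTo-both-terms = begin
      sumTo (λ d → divisorTerm u d + multipleTerm d) (u * p)
        ≡⟨ sumTo-+ (divisorTerm u) multipleTerm (u * p) ⟩
      sumTo (divisorTerm u) (u * p) + sumTo multipleTerm (u * p)
        ≡⟨ cong₂ _+_ sumTo-divisorTerm sumTo-multipleTerm ⟩
      σ u + p * σ u
        ≡⟨ cong (σ u +_) (*-comm p (σ u)) ⟩
      σ u + σ u * p
        ≡⟨ sym (*-suc (σ u) p) ⟩
      σ u * suc p ∎
      where open ≡-Reasoning

    σ-*-prime-≤ : σ (u * p) ≤ σ u * suc p
    σ-*-prime-≤ = begin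
      σ (u * p)                                     ≡⟨ σ≡sumTo-divisorTerm (u * p) ⟩
      sumTo (divisorTerm (u * p)) (u * p)           ≤⟨ sumTo-mono-≤ (u * p) divisorTerm-*-≤ ⟩
      sumTo (λ d → divisorTerm u d + multipleTerm d) (u * p) ≡⟨ sumTo-both-terms ⟩
      σ u * suc p                                   ∎
      where open ≤-Reasoning

    σ-*-prime : ¬ p ∣ u → σ (u * p) ≡ σ u * suc p
    σ-*-prime p∤u = ≤-antisym σ-*-prime-≤ (begin
      σ u * suc p                                   ≡⟨ sym sumTo-both-terms ⟩
      sumTo (λ d → divisorTerm u d + multipleTerm d) (u * p) ≤⟨ sumTo-mono-≤ (u * p) (divisorTerm-*-≥ p∤u) ⟩
      sumTo (divisorTerm (u * p)) (u * p)           ≡⟨ sym (σ≡sumTo-divisorTerm (u * p)) ⟩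
      σ (u * p)                                     ∎)
      where open ≤-Reasoning

-- Finite products, factorials and binomial coefficients

productTo : (ℕ → ℕ) → ℕ → ℕ
productTo f zero    = 1
productTo f (suc n) = productTo f n * f (suc n)

productTo-cong : ∀ {f g} n → (∀ i → 1 ≤ i → i ≤ n → f i ≡ g i) → productTo f n ≡ productTo g n
productTo-cong zero    _   = refl
productTo-cong (suc n) f≡g =
  cong₂ _*_ (productTo-cong n λ i 1≤i i≤n → f≡g i 1≤i (m≤n⇒m≤1+n i≤n)) (f≡g (suc n) (s≤s z≤n) ≤-refl)

productTo-mono-≤ : ∀ {f g} n → (∀ i → f i ≤ g i) → productTo f n ≤ productTo g n
productTo-mono-≤ zero    _   = ≤-refl
productTo-mono-≤ (suc n) f≤g = *-mono-≤ (productTo-mono-≤ n f≤g) (f≤g (suc n))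

productTo-* : ∀ f g n → productTo (λ i → f i * g i) n ≡ productTo f n * productTo g n
productTo-* f g zero    = refl
productTo-* f g (suc n) = trans (cong (_* (f (suc n) * g (suc n))) (productTo-* f g n)) (swap (productTo f n) _ _ _)
  where
  swap : ∀ a b c d → a * b * (c * d) ≡ a * c * (b * d)
  swap = solve-∀

productTo-split : ∀ f a b → productTo f (a + b) ≡ productTo f a * productTo (λ i → f (a + i)) b
productTo-split f a zero    = trans (cong (productTo f) (+-identityʳ a)) (sym (*-identityʳ _))
productTo-split f a (suc b) = begin
  productTo f (a + suc b)                                    ≡⟨ cong (productTo f) (+-suc a b) ⟩
  productTo f (a + b) * f (suc (a + b))                      ≡⟨ cong₂ _*_ (productTo-split f a b) (cong f (sym (+-suc a b))) ⟩
  productTo f a * productTo (λ i → f (a + i)) b * f (a + suc b) ≡⟨ *-assoc (productTo f a) _ _ ⟩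
  productTo f a * productTo (λ i → f (a + i)) (suc b)        ∎
  where open ≡-Reasoning

productTo-one : ∀ f n → (∀ i → 1 ≤ i → i ≤ n → f i ≡ 1) → productTo f n ≡ 1
productTo-one f n f≡1 = trans (productTo-cong n f≡1) (productTo-const1 n)
  where
  productTo-const1 : ∀ n → productTo (λ _ → 1) n ≡ 1
  productTo-const1 zero    = refl
  productTo-const1 (suc n) = trans (*-identityʳ _) (productTo-const1 n)

productTo-pos : ∀ f n → (∀ i → 0 < f i) → 0 < productTo f n
productTo-pos f zero    _   = s≤s z≤n
productTo-pos f (suc n) f>0 = *-mono-≤ (productTo-pos f n f>0) (f>0 (suc n))

∣productTo : ∀ f n i → 1 ≤ i → i ≤ n → f i ∣ productTo f n
∣productTo f zero    i (s≤s _) ()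
∣productTo f (suc n) i 1≤i i≤1+n with m≤n⇒m<n∨m≡n i≤1+n
... | inj₁ (s≤s i≤n) = ∣-trans (∣productTo f n i 1≤i i≤n) (m∣m*n (f (suc n)))
... | inj₂ refl      = n∣m*n (productTo f n)

productTo-≤-^ : ∀ f c n → (∀ i → f i ≤ c) → productTo f n ≤ c ^ n
productTo-≤-^ f c zero    _   = ≤-refl
productTo-≤-^ f c (suc n) f≤c = ≤-trans (*-mono-≤ (productTo-≤-^ f c n f≤c) (f≤c (suc n))) (≤-reflexive (*-comm (c ^ n) c))

productTo-≤-^-support : ∀ f c r n → 1 ≤ c → (∀ i → f i ≤ c) → (∀ i → r ≤ i → f i ≡ 1) → productTo f n ≤ c ^ r
productTo-≤-^-support f c r n 1≤c f≤c f≡1 with n ≤? r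
... | yes n≤r = ≤-trans (productTo-≤-^ f c n f≤c) (^-monoʳ-≤ c {{>-nonZero 1≤c}} n≤r)
... | no  n≰r = begin
  productTo f n                                        ≡⟨ cong (productTo f) (sym (m+[n∸m]≡n r≤n)) ⟩
  productTo f (r + (n ∸ r))                            ≡⟨ productTo-split f r (n ∸ r) ⟩
  productTo f r * productTo (λ i → f (r + i)) (n ∸ r)  ≡⟨ cong (productTo f r *_) (productTo-one _ (n ∸ r) beyond-r) ⟩
  productTo f r * 1                                    ≡⟨ *-identityʳ _ ⟩
  productTo f r                                        ≤⟨ productTo-≤-^ f c r f≤c ⟩
  c ^ r                                                ∎
  where
  open ≤-Reasoning
  r≤n : r ≤ n
  r≤n = <⇒≤ (≰⇒> n≰r)
  beyond-r : ∀ i → 1 ≤ i → i ≤ n ∸ r → f (r + i) ≡ 1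
  beyond-r i _ _ = f≡1 (r + i) (m≤m+n r i)

prime∣n! : ∀ {p n} → Prime p → p ≤ n → p ∣ n !
prime∣n! {suc p-1} _ p≤n = ∣-trans (m∣m*n (p-1 !)) (m≤n⇒m!∣n! p≤n)

prime∤n! : ∀ {p} → Prime p → ∀ n → n < p → ¬ p ∣ n !
prime∤n! pp zero    _   = prime∤1 pp
prime∤n! pp (suc n) n<p p∣n! with euclidsLemma (suc n) (n !) pp p∣n!
... | inj₁ p∣1+n = <⇒≱ n<p (∣⇒≤ p∣1+n)
... | inj₂ p∣n!′ = prime∤n! pp n (<-trans (n<1+n n) n<p) p∣n!′

C-*-factorials : ∀ {n k} → k ≤ n → (n C k) * (k ! * (n ∸ k) !) ≡ n !
C-*-factorials {n} {k} k≤n = trans (cong (_* (k ! * (n ∸ k) !)) (nCk≡n!/k![n-k]! k≤n))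
                                   (m/n*n≡m {{k !* (n ∸ k) !≢0}} (k![n∸k]!∣n! k≤n))

centralBinomial : ℕ → ℕ
centralBinomial n = (n + n) C n

oddBinomial : ℕ → ℕ
oddBinomial m = suc (m + m) C m

centralBinomial-* : ∀ n → centralBinomial n * (n ! * n !) ≡ (n + n) !
centralBinomial-* n = subst (λ x → ((n + n) C n) * (n ! * x !) ≡ (n + n) !) (m+n∸m≡n n n) (C-*-factorials (m≤m+n n n))

oddBinomial-* : ∀ m → oddBinomial m * (m ! * (suc m) !) ≡ (suc (m + m)) !
oddBinomial-* m = subst (λ x → (suc (m + m) C m) * (m ! * x !) ≡ (suc (m + m)) !) 1+2m∸m≡1+m
                        (C-*-factorials (≤-trans (m≤m+n m m) (n≤1+n _)))
  where
  1+2m∸m≡1+m : suc (m + m) ∸ m ≡ suc m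
  1+2m∸m≡1+m = trans (cong (_∸ m) (sym (+-suc m m))) (m+n∸m≡n m (suc m))

centralBinomial-rec : ∀ n → centralBinomial (suc n) * suc n ≡ 2 * suc (n + n) * centralBinomial n
centralBinomial-rec n = *-cancelʳ-≡ _ _ (suc n * (n! * n!)) {{m*n≢0 (suc n) (n! * n!) {{_}} {{m*n≢0 n! n! {{n !≢0}} {{n !≢0}}}}}} (begin
  X′ * suc n * (suc n * (n! * n!))                       ≡⟨ regroup₁ X′ n n! ⟩
  X′ * ((suc n) ! * (suc n) !)                           ≡⟨ centralBinomial-* (suc n) ⟩
  (suc n + suc n) !                                      ≡⟨ cong (λ z → suc z !) (+-suc n n) ⟩
  suc (suc (n + n)) * (suc (n + n) * (n + n) !)          ≡⟨ cong (λ z → suc (suc (n + n)) * (suc (n + n) * z)) (sym (centralBinomial-* n)) ⟩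
  suc (suc (n + n)) * (suc (n + n) * (X * (n! * n!)))    ≡⟨ regroup₂ X n n! ⟩
  2 * suc (n + n) * X * (suc n * (n! * n!))              ∎)
  where
  open ≡-Reasoning
  n! = n !
  X  = centralBinomial n
  X′ = centralBinomial (suc n)
  regroup₁ : ∀ x k a → x * suc k * (suc k * (a * a)) ≡ x * (suc k * a * (suc k * a))
  regroup₁ = solve-∀
  regroup₂ : ∀ x k a → suc (suc (k + k)) * (suc (k + k) * (x * (a * a))) ≡ 2 * suc (k + k) * x * (suc k * (a * a))
  regroup₂ = solve-∀

oddBinomial-rec : ∀ m → oddBinomial (suc m) * suc (suc m) ≡ 2 * suc (suc (suc (m + m))) * oddBinomial m
oddBinomial-rec m = *-cancelʳ-≡ _ _ (suc m * (m! * m+1!)) {{m*n≢0 (suc m) (m! * m+1!) {{_}} {{m*n≢0 m! m+1! {{m !≢0}} {{(suc m) !≢0}}}}}} (begin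
  Y′ * suc (suc m) * (suc m * (m! * m+1!))                           ≡⟨ regroup₁ Y′ m m! ⟩
  Y′ * ((suc m) ! * (suc (suc m)) !)                                 ≡⟨ oddBinomial-* (suc m) ⟩
  (suc (suc m + suc m)) !                                            ≡⟨ cong (λ z → suc (suc z) !) (+-suc m m) ⟩
  suc (suc (suc (m + m))) * (suc (suc (m + m)) * (suc (m + m)) !)   ≡⟨ cong (λ z → suc (suc (suc (m + m))) * (suc (suc (m + m)) * z)) (sym (oddBinomial-* m)) ⟩
  suc (suc (suc (m + m))) * (suc (suc (m + m)) * (Y * (m! * m+1!)))  ≡⟨ regroup₂ Y m m! ⟩
  2 * suc (suc (suc (m + m))) * Y * (suc m * (m! * m+1!))            ∎)
  where
  open ≡-Reasoning
  m!   = m !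
  m+1! = (suc m) !
  Y    = oddBinomial m
  Y′   = oddBinomial (suc m)
  regroup₁ : ∀ x k a → x * suc (suc k) * (suc k * (a * (suc k * a))) ≡ x * (suc k * a * (suc (suc k) * (suc k * a)))
  regroup₁ = solve-∀
  regroup₂ : ∀ x k a → suc (suc (suc (k + k))) * (suc (suc (k + k)) * (x * (a * (suc k * a)))) ≡ 2 * suc (suc (suc (k + k))) * x * (suc k * (a * (suc k * a)))
  regroup₂ = solve-∀

4^n≤[2n+1]*centralBinomial : ∀ n → 4 ^ n ≤ suc (n + n) * centralBinomial n
4^n≤[2n+1]*centralBinomial zero    = ≤-refl
4^n≤[2n+1]*centralBinomial (suc n) = *-cancelˡ-≤ (suc n) (begin
  suc n * 4 ^ suc n                                    ≡⟨ regroup₁ n (4 ^ n) ⟩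
  4 * suc n * 4 ^ n                                    ≤⟨ *-monoʳ-≤ (4 * suc n) (4^n≤[2n+1]*centralBinomial n) ⟩
  4 * suc n * (suc (n + n) * X)                        ≤⟨ *-monoˡ-≤ (suc (n + n) * X) (m≤m+n (4 * suc n) 2) ⟩
  (4 * suc n + 2) * (suc (n + n) * X)                  ≡⟨ regroup₂ n X ⟩
  suc (suc n + suc n) * (2 * suc (n + n) * X)          ≡⟨ cong (suc (suc n + suc n) *_) (sym (centralBinomial-rec n)) ⟩
  suc (suc n + suc n) * (centralBinomial (suc n) * suc n) ≡⟨ regroup₃ (suc (suc n + suc n)) (centralBinomial (suc n)) (suc n) ⟩
  suc n * (suc (suc n + suc n) * centralBinomial (suc n)) ∎)
  where
  open ≤-Reasoning
  X = centralBinomial n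
  regroup₁ : ∀ k a → suc k * (4 * a) ≡ 4 * suc k * a
  regroup₁ = solve-∀
  regroup₂ : ∀ k x → (4 * suc k + 2) * (suc (k + k) * x) ≡ suc (suc k + suc k) * (2 * suc (k + k) * x)
  regroup₂ = solve-∀
  regroup₃ : ∀ a b c → a * (b * c) ≡ c * (a * b)
  regroup₃ = solve-∀

oddBinomial>0 : ∀ m → 0 < oddBinomial m
oddBinomial>0 m = n≢0⇒n>0 λ Y≡0 → contradiction (trans (sym (oddBinomial-* m)) (cong (_* (m ! * (suc m) !)) Y≡0))
                                                 (>⇒≢ (>-nonZero⁻¹ _ {{(suc (m + m)) !≢0}}))

oddBinomial≤4^ : ∀ m → oddBinomial m ≤ 4 ^ m
oddBinomial≤4^ zero    = ≤-refl
oddBinomial≤4^ (suc m) = ≤-trans (*-cancelʳ-≤ (oddBinomial (suc m)) (4 * Y) (suc (suc m)) (begin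
  oddBinomial (suc m) * suc (suc m)     ≡⟨ oddBinomial-rec m ⟩
  2 * suc (suc (suc (m + m))) * Y       ≤⟨ *-monoˡ-≤ Y (≤-trans (m≤m+n _ 2) (≤-reflexive (regroup₁ m))) ⟩
  4 * suc (suc m) * Y                   ≡⟨ regroup₂ Y m ⟩
  4 * Y * suc (suc m)                   ∎)) (*-monoʳ-≤ 4 (oddBinomial≤4^ m))
  where
  open ≤-Reasoning
  Y = oddBinomial m
  regroup₁ : ∀ k → 2 * suc (suc (suc (k + k))) + 2 ≡ 4 * suc (suc k)
  regroup₁ = solve-∀
  regroup₂ : ∀ y k → 4 * suc (suc k) * y ≡ 4 * y * suc (suc k)
  regroup₂ = solve-∀

-- Floors, counting and Legendre's formula

m<[1+m/n]*n : ∀ m n .{{_ : NonZero n}} → m < suc (m / n) * n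
m<[1+m/n]*n m n = begin-strict
  m                 ≡⟨ m≡m%n+[m/n]*n m n ⟩
  m % n + m / n * n <⟨ +-monoˡ-< (m / n * n) (m%n<n m n) ⟩
  n + m / n * n     ∎
  where open ≤-Reasoning

/-unique : ∀ m d q .{{_ : NonZero d}} → q * d ≤ m → m < suc q * d → m / d ≡ q
/-unique m d q qd≤m m<[1+q]d =
  ≤-antisym (<⇒≤pred (m<n*o⇒m/o<n m<[1+q]d)) (subst (_≤ m / d) (m*n/n≡m q d) (/-monoˡ-≤ d qd≤m))

/-suc : ∀ d .{{_ : NonZero d}} m → suc m / d ≡ m / d + (if does (d ∣? suc m) then 1 else 0)
/-suc d m with d ∣? suc m
... | yes (divides zero 1+m≡0) = contradiction 1+m≡0 λ ()
... | yes (divides (suc c) 1+m≡[1+c]d) = begin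
  suc m / d ≡⟨ /-unique (suc m) d (suc c) (≤-reflexive (sym 1+m≡[1+c]d)) (subst (_< suc (suc c) * d) (sym 1+m≡[1+c]d) (*-monoˡ-< d (n<1+n (suc c)))) ⟩
  suc c     ≡⟨ +-comm 1 c ⟩
  c + 1     ≡⟨ cong (_+ 1) (sym m/d≡c) ⟩
  m / d + 1 ∎
  where
  open ≡-Reasoning
  m/d≡c : m / d ≡ c
  m/d≡c = /-unique m d c (<⇒≤pred (subst (c * d <_) (sym 1+m≡[1+c]d) (*-monoˡ-< d (n<1+n c)))) (≤-reflexive 1+m≡[1+c]d)
... | no d∤1+m = trans (/-unique (suc m) d (m / d) (≤-trans (m/n*n≤m m d) (n≤1+n m)) 1+m<[1+m/d]*d) (sym (+-identityʳ _))
  where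
  1+m<[1+m/d]*d : suc m < suc (m / d) * d
  1+m<[1+m/d]*d with m≤n⇒m<n∨m≡n (m<[1+m/n]*n m d)
  ... | inj₁ lt = lt
  ... | inj₂ eq = contradiction (divides (suc (m / d)) eq) d∤1+m

/-double-≤ : ∀ d .{{_ : NonZero d}} a → (a + a) / d ≤ a / d + a / d + 1
/-double-≤ d a = <⇒≤pred (m<n*o⇒m/o<n (begin-strict
  a + a                     ≡⟨ cong₂ _+_ (m≡m%n+[m/n]*n a d) (m≡m%n+[m/n]*n a d) ⟩
  (r + q * d) + (r + q * d) <⟨ +-mono-< (+-monoˡ-< (q * d) (m%n<n a d)) (+-monoˡ-< (q * d) (m%n<n a d)) ⟩
  (d + q * d) + (d + q * d) ≡⟨ regroup d q ⟩
  suc (q + q + 1) * d       ∎))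
  where
  open ≤-Reasoning
  r = a % d
  q = a / d
  regroup : ∀ x y → (x + y * x) + (x + y * x) ≡ suc (y + y + 1) * x
  regroup = solve-∀

count : ∀ {Q : ℕ → Set} → Decidable Q → ℕ → ℕ
count Q? B = sumTo (λ j → if does (Q? j) then 1 else 0) B

count≤ : ∀ {Q : ℕ → Set} (Q? : Decidable Q) B → count Q? B ≤ B
count≤ Q? zero    = z≤n
count≤ Q? (suc B) = subst (_≤ suc B) (+-comm _ (count Q? B)) (+-mono-≤ (indicator≤1 (suc B)) (count≤ Q? B))
  where
  indicator≤1 : ∀ j → (if does (Q? j) then 1 else 0) ≤ 1
  indicator≤1 j with Q? j
  ... | yes _ = ≤-refl
  ... | no  _ = z≤n

-- For a downward closed Q, count Q? B is the largest j ≤ B with Q j.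
count-downClosed : ∀ {Q : ℕ → Set} (Q? : Decidable Q) → (∀ {i j} → i ≤ j → Q j → Q i) → Q 0 →
  ∀ B → Q (count Q? B) × (count Q? B ≡ B ⊎ ¬ Q (suc (count Q? B)))
count-downClosed Q? down Q0 zero = Q0 , inj₁ refl
count-downClosed {Q} Q? down Q0 (suc B) with count-downClosed Q? down Q0 B | Q? (suc B)
... | Qc , c≡B⊎¬Q[1+c] | yes Q[1+B] = subst (λ c → Q c × (c ≡ suc B ⊎ ¬ Q (suc c))) (sym c′≡1+B) (Q[1+B] , inj₁ refl)
  where
  c≡B : count Q? B ≡ B
  c≡B = [ (λ eq → eq) , (λ ¬Q → contradiction (down (s≤s (count≤ Q? B)) Q[1+B]) ¬Q) ]′ c≡B⊎¬Q[1+c]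
  c′≡1+B : count Q? B + 1 ≡ suc B
  c′≡1+B = trans (+-comm (count Q? B) 1) (cong suc c≡B)
... | Qc , c≡B⊎¬Q[1+c] | no ¬Q[1+B] = subst (λ c → Q c × (c ≡ suc B ⊎ ¬ Q (suc c))) (sym (+-identityʳ _)) (Qc , inj₂ ¬Q[1+c])
  where
  ¬Q[1+c] : ¬ Q (suc (count Q? B))
  ¬Q[1+c] = [ (λ c≡B → subst (λ c → ¬ Q (suc c)) (sym c≡B) ¬Q[1+B]) , (λ ¬Q → ¬Q) ]′ c≡B⊎¬Q[1+c]

sumTo-≥-first : ∀ f B → 1 ≤ B → f 1 ≤ sumTo f B
sumTo-≥-first f (suc zero)    _ = ≤-refl
sumTo-≥-first f (suc (suc B)) _ = ≤-trans (sumTo-≥-first f (suc B) (s≤s z≤n)) (m≤m+n _ _)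

sumTo-≤-first : ∀ f → (∀ j → 2 ≤ j → f j ≡ 0) → ∀ B → sumTo f B ≤ f 1
sumTo-≤-first f f≡0 zero          = z≤n
sumTo-≤-first f f≡0 (suc zero)    = ≤-refl
sumTo-≤-first f f≡0 (suc (suc B)) =
  subst (_≤ f 1) (sym (trans (cong (sumTo f (suc B) +_) (f≡0 (suc (suc B)) (s≤s (s≤s z≤n)))) (+-identityʳ _)))
        (sumTo-≤-first f f≡0 (suc B))

logCount : ℕ → ℕ → ℕ
logCount b x = count (λ j → b ^ j ≤? x) x

b^logCount≤ : ∀ b .{{_ : NonZero b}} x → 1 ≤ x → b ^ logCount b x ≤ x
b^logCount≤ b x 1≤x =
  proj₁ (count-downClosed (λ j → b ^ j ≤? x) (λ i≤j b^j≤x → ≤-trans (^-monoʳ-≤ b i≤j) b^j≤x) 1≤x x)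

infix 4 _^_∥_
_^_∥_ : ℕ → ℕ → ℕ → Set
p ^ e ∥ x = p ^ e ∣ x × ¬ p ^ suc e ∣ x

module Valuation {p} (p-prime : Prime p) where
  private instance
    p≢0 : NonZero p
    p≢0 = prime⇒nonZero p-prime

  infixl 7 _/p^_
  _/p^_ : ℕ → ℕ → ℕ
  m /p^ j = (m / p ^ j) {{m^n≢0 p j}}

  ^-monoʳ-∣ : ∀ {i j} → i ≤ j → p ^ i ∣ p ^ j
  ^-monoʳ-∣ {i} {j} i≤j = subst (p ^ i ∣_) p^i*p^[j-i]≡p^j (m∣m*n (p ^ (j ∸ i)))
    where
    p^i*p^[j-i]≡p^j : p ^ i * p ^ (j ∸ i) ≡ p ^ j
    p^i*p^[j-i]≡p^j = trans (sym (^-distribˡ-+-* p i (j ∸ i))) (cong (p ^_) (m+[n∸m]≡n i≤j))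

  n<p^n : ∀ n → n < p ^ n
  n<p^n zero    = s≤s z≤n
  n<p^n (suc n) = begin-strict
    suc n         ≤⟨ n<p^n n ⟩
    p ^ n         <⟨ m<m+n (p ^ n) (m^n>0 p n) ⟩
    p ^ n + p ^ n ≡⟨ cong (p ^ n +_) (sym (+-identityʳ (p ^ n))) ⟩
    2 * p ^ n     ≤⟨ *-monoˡ-≤ (p ^ n) (prime≥2 p-prime) ⟩
    p * p ^ n     ∎
    where open ≤-Reasoning

  ∥-* : ∀ {i j a b} → p ^ i ∥ a → p ^ j ∥ b → p ^ (i + j) ∥ a * b
  ∥-* {i} {j} {a} {b} (p^i∣a , p^1+i∤a) (p^j∣b , p^1+j∤b) =
    subst (_∣ a * b) (sym (^-distribˡ-+-* p i j)) (*-pres-∣ p^i∣a p^j∣b) , p^1+i+j∤ab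
    where
    a′ = quotient p^i∣a
    b′ = quotient p^j∣b
    p∤a′ : ¬ p ∣ a′
    p∤a′ p∣a′ = p^1+i∤a (subst (p ^ suc i ∣_) (sym (m∣n⇒n≡m*quotient p^i∣a))
                          (subst (_∣ p ^ i * a′) (*-comm (p ^ i) p) (*-monoʳ-∣ (p ^ i) p∣a′)))
    p∤b′ : ¬ p ∣ b′
    p∤b′ p∣b′ = p^1+j∤b (subst (p ^ suc j ∣_) (sym (m∣n⇒n≡m*quotient p^j∣b))
                          (subst (_∣ p ^ j * b′) (*-comm (p ^ j) p) (*-monoʳ-∣ (p ^ j) p∣b′)))
    ab≡p^[i+j]*a′b′ : a * b ≡ p ^ (i + j) * (a′ * b′)
    ab≡p^[i+j]*a′b′ = begin
      a * b                         ≡⟨ cong₂ _*_ (m∣n⇒n≡m*quotient p^i∣a) (m∣n⇒n≡m*quotient p^j∣b) ⟩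
      p ^ i * a′ * (p ^ j * b′)     ≡⟨ regroup (p ^ i) (p ^ j) a′ b′ ⟩
      p ^ i * p ^ j * (a′ * b′)     ≡⟨ cong (_* (a′ * b′)) (sym (^-distribˡ-+-* p i j)) ⟩
      p ^ (i + j) * (a′ * b′)       ∎
      where
      open ≡-Reasoning
      regroup : ∀ x y z w → x * z * (y * w) ≡ x * y * (z * w)
      regroup = solve-∀
    p^1+i+j∤ab : ¬ p ^ suc (i + j) ∣ a * b
    p^1+i+j∤ab p^1+i+j∣ab = [ p∤a′ , p∤b′ ]′ (euclidsLemma a′ b′ p-prime
      (*-cancelˡ-∣ (p ^ (i + j)) {{m^n≢0 p (i + j)}} (subst₂ _∣_ (*-comm p (p ^ (i + j))) ab≡p^[i+j]*a′b′ p^1+i+j∣ab)))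

  ∥⇒≤ : ∀ {e x k} → p ^ e ∥ x → p ^ k ∣ x → k ≤ e
  ∥⇒≤ {e} {k = k} (_ , p^1+e∤x) p^k∣x with k ≤? e
  ... | yes k≤e = k≤e
  ... | no  k≰e = contradiction (∣-trans (^-monoʳ-∣ (≰⇒> k≰e)) p^k∣x) p^1+e∤x

  ∥-count : ∀ B x → 0 < x → x < p ^ suc B → p ^ count (λ j → p ^ j ∣? x) B ∥ x
  ∥-count B x x>0 x<p^[1+B]
    with count-downClosed (λ j → p ^ j ∣? x) (λ i≤j p^j∣x → ∣-trans (^-monoʳ-∣ i≤j) p^j∣x) (1∣ x) B
  ... | p^c∣x , inj₂ p^[1+c]∤x = p^c∣x , p^[1+c]∤x
  ... | p^c∣x , inj₁ c≡B       = p^c∣x , λ p^[1+c]∣x →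
    <⇒≱ x<p^[1+B] (subst (λ c → p ^ suc c ≤ x) c≡B (∣⇒≤ {{>-nonZero x>0}} p^[1+c]∣x))

  legendreSum : ℕ → ℕ → ℕ
  legendreSum B m = sumTo (m /p^_) B

  legendreSum-suc : ∀ B m → legendreSum B (suc m) ≡ legendreSum B m + count (λ j → p ^ j ∣? suc m) B
  legendreSum-suc B m = trans (sumTo-cong B λ j _ _ → /-suc (p ^ j) {{m^n≢0 p j}} m) (sumTo-+ (m /p^_) _ B)

  legendre : ∀ B m → m < p ^ suc B → p ^ legendreSum B m ∥ m !
  legendre B zero _ = subst (λ e → p ^ e ∥ 1) (sym (sumTo-zero _ B λ j _ _ → m<n⇒m/n≡0 {{m^n≢0 p j}} (m^n>0 p j)))
    (∣-refl , λ p∣1 → <⇒≱ (≤-trans (prime≥2 p-prime) (≤-reflexive (sym (*-identityʳ p)))) (∣⇒≤ p∣1))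
  legendre B (suc m) 1+m<p^[1+B] =
    subst (λ e → p ^ e ∥ suc m !) (trans (+-comm (count (λ j → p ^ j ∣? suc m) B) _) (sym (legendreSum-suc B m)))
      (∥-* {count (λ j → p ^ j ∣? suc m) B} {legendreSum B m} (∥-count B (suc m) (s≤s z≤n) 1+m<p^[1+B])
           (legendre B m (<-trans (n<1+n m) 1+m<p^[1+B])))

  module _ {n} (1≤n : 1 ≤ n) where
    private
      L₁ = legendreSum (n + n) n
      L₂ = legendreSum (n + n) (n + n)

      ∥n! : p ^ L₁ ∥ n !
      ∥n! = legendre (n + n) n (<-≤-trans (n<p^n n) (^-monoʳ-≤ p (≤-trans (m≤m+n n n) (n≤1+n _))))

      ∥[2n]! : p ^ L₂ ∥ (n + n) !
      ∥[2n]! = legendre (n + n) (n + n) (<-≤-trans (n<p^n (n + n)) (^-monoʳ-≤ p (n≤1+n (n + n))))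

      floor-step : ∀ j → (n + n) /p^ j ≤ (n /p^ j + n /p^ j) + (if does (p ^ j ≤? n + n) then 1 else 0)
      floor-step j with p ^ j ≤? n + n
      ... | yes p^j≤2n  = ≤-trans (/-double-≤ (p ^ j) {{m^n≢0 p j}} n)
                                  (≤-reflexive (cong (n /p^ j + n /p^ j +_) (sym (if-does-yes (p ^ j ≤? n + n) p^j≤2n))))
      ... | no  p^j≰2n  = ≤-trans (≤-reflexive (m<n⇒m/n≡0 {{m^n≢0 p j}} (≰⇒> p^j≰2n))) z≤n

      L₂≤2L₁+logCount : L₂ ≤ (L₁ + L₁) + logCount p (n + n)
      L₂≤2L₁+logCount = begin
        L₂                                                    ≤⟨ sumTo-mono-≤ (n + n) floor-step ⟩
        sumTo (λ j → (n /p^ j + n /p^ j) + (if does (p ^ j ≤? n + n) then 1 else 0)) (n + n)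
                                                              ≡⟨ sumTo-+ (λ j → n /p^ j + n /p^ j) _ (n + n) ⟩
        sumTo (λ j → n /p^ j + n /p^ j) (n + n) + logCount p (n + n)
                                                              ≡⟨ cong (_+ logCount p (n + n)) (sumTo-+ (n /p^_) (n /p^_) (n + n)) ⟩
        (L₁ + L₁) + logCount p (n + n)                        ∎
        where open ≤-Reasoning

      p^[k+2L₁]∣[2n]! : ∀ {k} → p ^ k ∣ centralBinomial n → p ^ (k + (L₁ + L₁)) ∣ (n + n) !
      p^[k+2L₁]∣[2n]! {k} p^k∣X = subst₂ _∣_ (sym p^[k+2L₁]≡) (centralBinomial-* n) (*-pres-∣ p^k∣X (*-pres-∣ (proj₁ ∥n!) (proj₁ ∥n!)))
        where
        p^[k+2L₁]≡ : p ^ (k + (L₁ + L₁)) ≡ p ^ k * (p ^ L₁ * p ^ L₁)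
        p^[k+2L₁]≡ = trans (^-distribˡ-+-* p k (L₁ + L₁)) (cong (p ^ k *_) (^-distribˡ-+-* p L₁ L₁))

    ^∣centralBinomial⇒≤logCount : ∀ {k} → p ^ k ∣ centralBinomial n → k ≤ logCount p (n + n)
    ^∣centralBinomial⇒≤logCount {k} p^k∣X = +-cancelʳ-≤ (L₁ + L₁) k (logCount p (n + n)) (begin
      k + (L₁ + L₁)                ≤⟨ ∥⇒≤ ∥[2n]! (p^[k+2L₁]∣[2n]! {k} p^k∣X) ⟩
      L₂                           ≤⟨ L₂≤2L₁+logCount ⟩
      (L₁ + L₁) + logCount p (n + n) ≡⟨ +-comm (L₁ + L₁) _ ⟩
      logCount p (n + n) + (L₁ + L₁) ∎)
      where open ≤-Reasoning

    ^∣centralBinomial⇒≤ : ∀ {k} → p ^ k ∣ centralBinomial n → p ^ k ≤ n + n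
    ^∣centralBinomial⇒≤ {k} p^k∣X =
      ≤-trans (^-monoʳ-≤ p (^∣centralBinomial⇒≤logCount {k} p^k∣X)) (b^logCount≤ p (n + n) (≤-trans 1≤n (m≤m+n n n)))

    -- Erdős: a prime in (2n/3, n] occurs in (2n)! exactly twice, once in each factor n!.
    ∤centralBinomial : 3 ≤ n → p ≤ n → n + n < 3 * p → ¬ p ∣ centralBinomial n
    ∤centralBinomial 3≤n p≤n 2n<3p p∣X = <⇒≱ (s≤s (s≤s (s≤s z≤n))) (begin
      3              ≤⟨ +-monoʳ-≤ 1 (+-mono-≤ 1≤L₁ 1≤L₁) ⟩
      1 + (L₁ + L₁)  ≤⟨ ∥⇒≤ ∥[2n]! (p^[k+2L₁]∣[2n]! {1} (subst (_∣ centralBinomial n) (sym (*-identityʳ p)) p∣X)) ⟩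
      L₂             ≤⟨ L₂≤2 ⟩
      2              ∎)
      where
      open ≤-Reasoning
      3≤p : 3 ≤ p
      3≤p with 3 ≤? p
      ... | yes 3≤p = 3≤p
      ... | no  3≰p = contradiction 2n<3p (≤⇒≯ (≤-trans (*-monoʳ-≤ 3 (<⇒≤pred (≰⇒> 3≰p))) (+-mono-≤ 3≤n 3≤n)))
      1≤L₁ : 1 ≤ L₁
      1≤L₁ = ≤-trans (m≥n⇒m/n>0 {{m^n≢0 p 1}} (subst (_≤ n) (sym (*-identityʳ p)) p≤n))
                     (sumTo-≥-first _ (n + n) (≤-trans 1≤n (m≤m+n n n)))
      2n<p^j : ∀ j → 2 ≤ j → n + n < p ^ j
      2n<p^j j 2≤j = begin-strict
        n + n  <⟨ 2n<3p ⟩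
        3 * p  ≤⟨ *-monoˡ-≤ p 3≤p ⟩
        p * p  ≡⟨ cong (p *_) (sym (*-identityʳ p)) ⟩
        p ^ 2  ≤⟨ ^-monoʳ-≤ p 2≤j ⟩
        p ^ j  ∎
      L₂≤2 : L₂ ≤ 2
      L₂≤2 = ≤-trans (sumTo-≤-first _ (λ j 2≤j → m<n⇒m/n≡0 {{m^n≢0 p j}} (2n<p^j j 2≤j)) (n + n))
                     (<⇒≤pred (m<n*o⇒m/o<n {{m^n≢0 p 1}} (subst (n + n <_) (cong (3 *_) (sym (*-identityʳ p))) 2n<3p)))

-- Divisibility through prime powers and the primorial bound

∃prime∣ : ∀ n → 2 ≤ n → ∃[ p ] (Prime p × p ∣ n)
∃prime∣ n 2≤n = fromFactorisation (factorise n {{>-nonZero (<-trans (s≤s z≤n) 2≤n)}})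
  where
  fromFactorisation : PrimeFactorisation n → ∃[ p ] (Prime p × p ∣ n)
  fromFactorisation record { factors = [] ; isFactorisation = n≡1 } =
    contradiction (subst (2 ≤_) n≡1 2≤n) λ { (s≤s ()) }
  fromFactorisation record { factors = p ∷ ps ; isFactorisation = n≡p*ps ; factorsPrime = pp ∷ _ } =
    p , pp , divides (product ps) (trans n≡p*ps (*-comm p _))

prime∣^⇒∣ : ∀ {p r} k → Prime p → p ∣ r ^ k → p ∣ r
prime∣^⇒∣ zero    pp = ⊥-elim ∘ prime∤1 pp
prime∣^⇒∣ {r = r} (suc k) pp p∣r^[1+k] = [ (λ p∣r → p∣r) , prime∣^⇒∣ k pp ]′ (euclidsLemma r (r ^ k) pp p∣r^[1+k])

∣-byPrimePowers : ∀ x y → 0 < x → (∀ p k → Prime p → p ^ k ∣ x → p ^ k ∣ y) → x ∣ y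
∣-byPrimePowers = <-rec _ step
  where
  step : ∀ x → (∀ {x′} → x′ < x → ∀ y → 0 < x′ → (∀ p k → Prime p → p ^ k ∣ x′ → p ^ k ∣ y) → x′ ∣ y) →
         ∀ y → 0 < x → (∀ p k → Prime p → p ^ k ∣ x → p ^ k ∣ y) → x ∣ y
  step (suc zero) _ y _ _ = 1∣ y
  step x@(suc (suc _)) rec y _ powers with ∃prime∣ x (s≤s (s≤s z≤n))
  ... | p , pp , p∣x = subst₂ _∣_ (sym x≡p*x′) (sym y≡p*y′) (*-monoʳ-∣ p (rec x′<x y′ x′>0 powers′))
    where
    instance
      p≢0 : NonZero p
      p≢0 = prime⇒nonZero pp
    x′ = quotient p∣x
    x≡p*x′ : x ≡ p * x′
    x≡p*x′ = m∣n⇒n≡m*quotient p∣x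
    x′<x : x′ < x
    x′<x = quotient-< p∣x {{n>1⇒nonTrivial (prime≥2 pp)}}
    x′>0 : 0 < x′
    x′>0 = n≢0⇒n>0 λ x′≡0 → contradiction (trans x≡p*x′ (trans (cong (p *_) x′≡0) (*-zeroʳ p))) λ ()
    p∣y : p ∣ y
    p∣y = subst (_∣ y) (*-identityʳ p) (powers p 1 pp (subst (_∣ x) (sym (*-identityʳ p)) p∣x))
    y′ = quotient p∣y
    y≡p*y′ : y ≡ p * y′
    y≡p*y′ = m∣n⇒n≡m*quotient p∣y
    powers′ : ∀ r k → Prime r → r ^ k ∣ x′ → r ^ k ∣ y′
    powers′ r k pr r^k∣x′ with r ≟ p
    ... | yes refl = *-cancelˡ-∣ p (subst (p * p ^ k ∣_) y≡p*y′
                       (powers p (suc k) pp (subst (p * p ^ k ∣_) (sym x≡p*x′) (*-monoʳ-∣ p r^k∣x′))))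
    ... | no  r≢p  = coprime-divisor (prime∤⇒coprime pp p∤r^k) (subst (r ^ k ∣_) y≡p*y′
                       (powers r k pr (∣-trans r^k∣x′ (subst (x′ ∣_) (trans (*-comm x′ p) (sym x≡p*x′)) (m∣m*n p)))))
      where
      p∤r^k : ¬ p ∣ r ^ k
      p∤r^k p∣r^k = r≢p (sym (prime∣prime⇒≡ pp pr (prime∣^⇒∣ k pp p∣r^k)))

coprime-*-∣ : ∀ {a q y} → Prime q → ¬ q ∣ a → a ∣ y → q ∣ y → a * q ∣ y
coprime-*-∣ {a} {q} pq q∤a (divides t refl) q∣ta = subst (a * q ∣_) (*-comm a t) aq∣at
  where
  q∣t : q ∣ t
  q∣t = coprime-divisor (Coprime-sym (prime∤⇒coprime pq q∤a)) (subst (q ∣_) (*-comm t a) q∣ta)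
  aq∣at : a * q ∣ a * t
  aq∣at = *-monoʳ-∣ a q∣t

primeOrOne : ℕ → ℕ
primeOrOne i = if does (prime? i) then i else 1

primorial : ℕ → ℕ
primorial = productTo primeOrOne

prime∣oddBinomial : ∀ m q → Prime q → suc m < q → q ≤ suc (m + m) → q ∣ oddBinomial m
prime∣oddBinomial m q pq m+1<q q≤2m+1
  with euclidsLemma (oddBinomial m) (m ! * (suc m) !) pq (subst (q ∣_) (sym (oddBinomial-* m)) (prime∣n! pq q≤2m+1))
... | inj₁ q∣Y          = q∣Y
... | inj₂ q∣m!*[m+1]! with euclidsLemma (m !) ((suc m) !) pq q∣m!*[m+1]!
...   | inj₁ q∣m!     = contradiction q∣m! (prime∤n! pq m (<-trans (n<1+n m) m+1<q))
...   | inj₂ q∣[m+1]! = contradiction q∣[m+1]! (prime∤n! pq (suc m) m+1<q)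

prime∤productTo : ∀ {q} f j → Prime q → (∀ i → 1 ≤ i → i ≤ j → ¬ q ∣ f i) → ¬ q ∣ productTo f j
prime∤productTo f zero    pq _     = prime∤1 pq
prime∤productTo f (suc j) pq q∤f q∣∏ =
  [ prime∤productTo f j pq (λ i 1≤i i≤j → q∤f i 1≤i (m≤n⇒m≤1+n i≤j)) , q∤f (suc j) (s≤s z≤n) ≤-refl ]′
    (euclidsLemma _ _ pq q∣∏)

productTo-primesAbove∣oddBinomial : ∀ m j → j ≤ m → productTo (λ i → primeOrOne (suc m + i)) j ∣ oddBinomial m
productTo-primesAbove∣oddBinomial m zero    _     = 1∣ _
productTo-primesAbove∣oddBinomial m (suc j) 1+j≤m with prime? (suc m + suc j)
... | no  _  = subst (_∣ oddBinomial m) (sym (*-identityʳ _)) previous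
  where previous = productTo-primesAbove∣oddBinomial m j (≤-trans (n≤1+n j) 1+j≤m)
... | yes pq = coprime-*-∣ pq q∤previous previous
                 (prime∣oddBinomial m (suc m + suc j) pq (m<m+n (suc m) (s≤s z≤n)) (s≤s (+-monoʳ-≤ m 1+j≤m)))
  where
  previous = productTo-primesAbove∣oddBinomial m j (≤-trans (n≤1+n j) 1+j≤m)
  q∤previous : ¬ suc m + suc j ∣ productTo (λ i → primeOrOne (suc m + i)) j
  q∤previous = prime∤productTo _ j pq q∤factor
    where
    q∤factor : ∀ i → 1 ≤ i → i ≤ j → ¬ suc m + suc j ∣ primeOrOne (suc m + i)
    q∤factor i _ i≤j q∣f with prime? (suc m + i)
    ... | yes pr = <⇒≢ (+-monoʳ-< (suc m) (s≤s i≤j)) (sym (prime∣prime⇒≡ pq pr q∣f))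
    ... | no  _  = prime∤1 pq q∣f

even⊎odd : ∀ n → ∃[ m ] (n ≡ m + m ⊎ n ≡ suc (m + m))
even⊎odd zero    = 0 , inj₁ refl
even⊎odd (suc n) with even⊎odd n
... | m , inj₁ n≡2m   = m , inj₂ (cong suc n≡2m)
... | m , inj₂ n≡2m+1 = suc m , inj₁ (trans (cong suc n≡2m+1) (cong suc (sym (+-suc m m))))

-- Erdős: the primes in (m + 1, 2m + 1] all divide the binomial coefficient (2m + 1 choose m) ≤ 4 ^ m.
primorial≤4^ : ∀ n → primorial n ≤ 4 ^ n
primorial≤4^ = <-rec _ step
  where
  step : ∀ n → (∀ {n′} → n′ < n → primorial n′ ≤ 4 ^ n′) → primorial n ≤ 4 ^ n
  step 0 _ = ≤-refl
  step 1 _ = s≤s z≤n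
  step 2 _ = s≤s (s≤s z≤n)
  step n@(suc n-1@(suc (suc _))) rec with even⊎odd n
  ... | zero , inj₁ ()
  ... | zero , inj₂ ()
  ... | suc m , inj₁ n≡2m+2 = begin
    primorial n-1 * primeOrOne n ≡⟨ cong (primorial n-1 *_) (if-does-no (prime? n) n-composite) ⟩
    primorial n-1 * 1            ≡⟨ *-identityʳ _ ⟩
    primorial n-1                ≤⟨ rec (n<1+n n-1) ⟩
    4 ^ n-1                      ≤⟨ ^-monoʳ-≤ 4 (n≤1+n n-1) ⟩
    4 ^ n                        ∎
    where
    open ≤-Reasoning
    n-composite : ¬ Prime n
    n-composite pn = prime⇒¬composite pn (hasNonTrivialDivisor {divisor = 2} (s≤s (s≤s (s≤s z≤n)))
                       (divides (suc m) (trans n≡2m+2 (2m≡m*2 (suc m)))))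
      where
      2m≡m*2 : ∀ m → m + m ≡ m * 2
      2m≡m*2 = solve-∀
  ... | suc m , inj₂ n≡2m+3 = subst (λ n → primorial n ≤ 4 ^ n) (sym n≡2m+3) (begin
    primorial (suc (suc m) + suc m)                          ≡⟨ productTo-split primeOrOne (suc (suc m)) (suc m) ⟩
    primorial (suc (suc m)) * productTo (λ i → primeOrOne (suc (suc m) + i)) (suc m)
                                                             ≤⟨ *-mono-≤ (rec m+2<n) upper-primes≤4^ ⟩
    4 ^ suc (suc m) * 4 ^ suc m                              ≡⟨ sym (^-distribˡ-+-* 4 (suc (suc m)) (suc m)) ⟩
    4 ^ (suc (suc m) + suc m)                                ∎)
    where
    open ≤-Reasoning
    m+2<n : suc (suc m) < n
    m+2<n = subst (suc (suc m) <_) (sym n≡2m+3) (s≤s (s≤s (m≤n+m (suc m) m)))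
    upper-primes≤4^ : productTo (λ i → primeOrOne (suc (suc m) + i)) (suc m) ≤ 4 ^ suc m
    upper-primes≤4^ = ≤-trans (∣⇒≤ {{>-nonZero (oddBinomial>0 (suc m))}} (productTo-primesAbove∣oddBinomial (suc m) (suc m) ≤-refl))
                              (oddBinomial≤4^ (suc m))

-- Two primes in (n, 2n] for large n

m<m*n⇒1<n : ∀ {m n} → m < m * n → 1 < n
m<m*n⇒1<n {m} {n} m<mn with 1 <? n
... | yes 1<n = 1<n
... | no  1≮n = contradiction m<mn (≤⇒≯ (≤-trans (*-monoʳ-≤ m (≮⇒≥ 1≮n)) (≤-reflexive (*-identityʳ m))))

TwoPrimesIn : ℕ → ℕ → Set
TwoPrimesIn n N = ∃[ a ] ∃[ b ] (Prime a × Prime b × n < a × a < b × b ≤ N)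

centralBinomial>0 : ∀ n → 0 < centralBinomial n
centralBinomial>0 n = n≢0⇒n>0 λ X≡0 → contradiction (trans (sym (centralBinomial-* n)) (cong (_* (n ! * n !)) X≡0))
                                                     (>⇒≢ (>-nonZero⁻¹ _ {{(n + n) !≢0}}))

-- A prime power dividing C(2n, n) is at most 2n, and no prime in (2n/3, n] divides it, so the
-- three parts below account for every prime factor of C(2n, n).
module CentralBinomialFactors {n} (3≤n : 3 ≤ n) where
  private
    M = n + n
    K = M / 3
    1≤n : 1 ≤ n
    1≤n = ≤-trans (s≤s z≤n) 3≤n
    1≤M : 1 ≤ M
    1≤M = ≤-trans 1≤n (m≤m+n n n)

  smallPart mediumPart largePart : ℕ → ℕ
  smallPart i with prime? i | i * i ≤? M
  ... | yes _ | yes _ = i ^ logCount i M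
  ... | _     | _     = 1
  mediumPart i with prime? i | i ≤? K
  ... | yes _ | yes _ = i
  ... | _     | _     = 1
  largePart i with prime? i | n <? i
  ... | yes _ | yes _ = i
  ... | _     | _     = 1

  part : ℕ → ℕ
  part i = smallPart i * mediumPart i * largePart i

  ^∣centralBinomial⇒∣part : ∀ {p} k → Prime p → p ^ k ∣ centralBinomial n → p ^ k ∣ part p
  ^∣centralBinomial⇒∣part zero _ _ = 1∣ _
  ^∣centralBinomial⇒∣part {p} (suc k) pp p^k∣X with prime? p
  ... | no ¬pp = contradiction pp ¬pp
  ... | yes _ with p * p ≤? M
  ...   | yes _   = ∣-trans (^-monoʳ-∣ (^∣centralBinomial⇒≤logCount 1≤n {suc k} p^k∣X)) (∣-trans (m∣m*n _) (m∣m*n _))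
    where open Valuation pp
  ...   | no p²≰M with k
  ...     | suc k′ = contradiction (≤-trans p*p≤p^[2+k′] (^∣centralBinomial⇒≤ 1≤n {suc (suc k′)} p^k∣X)) p²≰M
    where
    open Valuation pp
    p*p≤p^[2+k′] : p * p ≤ p ^ suc (suc k′)
    p*p≤p^[2+k′] = *-monoʳ-≤ p (≤-trans (≤-reflexive (sym (*-identityʳ p))) (^-monoʳ-≤ p {{prime⇒nonZero pp}} (s≤s (z≤n {k′}))))
  ...     | zero with p ≤? K | n <? p
  ...       | yes _ | _     = ∣-trans (∣-reflexive (*-identityʳ p)) (n∣m*n*o 1 _)
  ...       | no _  | yes _ = ∣-trans (∣-reflexive (*-identityʳ p)) (n∣m*n (1 * 1))
  ...       | no p≰K | no p≮n =
    contradiction (subst (_∣ centralBinomial n) (*-identityʳ p) p^k∣X) (∤centralBinomial 1≤n 3≤n (≮⇒≥ p≮n) 2n<3p)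
    where
    open Valuation pp
    2n<3p : M < 3 * p
    2n<3p = <-≤-trans (m<[1+m/n]*n M 3) (≤-trans (*-monoˡ-≤ 3 (≰⇒> p≰K)) (≤-reflexive (*-comm p 3)))

  centralBinomial∣productTo-part : centralBinomial n ∣ productTo part M
  centralBinomial∣productTo-part = ∣-byPrimePowers _ _ (centralBinomial>0 n) powers
    where
    powers : ∀ p k → Prime p → p ^ k ∣ centralBinomial n → p ^ k ∣ productTo part M
    powers p zero    _  _     = 1∣ _
    powers p (suc k) pp p^k∣X = ∣-trans (^∣centralBinomial⇒∣part (suc k) pp p^k∣X) (∣productTo part M p (prime>0 pp) p≤M)
      where
      p≤M : p ≤ M
      p≤M = ≤-trans (≤-trans (≤-reflexive (sym (*-identityʳ p))) (^-monoʳ-≤ p {{prime⇒nonZero pp}} (s≤s (z≤n {k}))))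
                    (Valuation.^∣centralBinomial⇒≤ pp 1≤n {suc k} p^k∣X)

  part>0 : ∀ i → 0 < part i
  part>0 i = *-mono-≤ (*-mono-≤ (smallPart>0 i) (mediumPart>0 i)) (largePart>0 i)
    where
    smallPart>0 : ∀ i → 0 < smallPart i
    smallPart>0 i with prime? i | i * i ≤? M
    ... | yes pi | yes _ = m^n>0 i {{prime⇒nonZero pi}} (logCount i M)
    ... | yes _  | no _  = s≤s z≤n
    ... | no _   | _     = s≤s z≤n
    mediumPart>0 : ∀ i → 0 < mediumPart i
    mediumPart>0 i with prime? i | i ≤? K
    ... | yes pi | yes _ = prime>0 pi
    ... | yes _  | no _  = s≤s z≤n
    ... | no _   | _     = s≤s z≤n
    largePart>0 : ∀ i → 0 < largePart i
    largePart>0 i with prime? i | n <? i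
    ... | yes pi | yes _ = prime>0 pi
    ... | yes _  | no _  = s≤s z≤n
    ... | no _   | _     = s≤s z≤n

  productTo-smallPart≤ : ∀ r → M < r * r → productTo smallPart M ≤ M ^ r
  productTo-smallPart≤ r M<r² = productTo-≤-^-support smallPart M r M 1≤M smallPart≤M smallPart≡1
    where
    smallPart≤M : ∀ i → smallPart i ≤ M
    smallPart≤M i with prime? i | i * i ≤? M
    ... | yes pi | yes _ = b^logCount≤ i {{prime⇒nonZero pi}} M 1≤M
    ... | yes _  | no _  = 1≤M
    ... | no _   | _     = 1≤M
    smallPart≡1 : ∀ i → r ≤ i → smallPart i ≡ 1
    smallPart≡1 i r≤i with prime? i | i * i ≤? M
    ... | yes _ | yes i²≤M = contradiction (≤-trans (*-mono-≤ r≤i r≤i) i²≤M) (<⇒≱ M<r²)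
    ... | yes _ | no _     = refl
    ... | no _  | _        = refl

  productTo-mediumPart≤ : productTo mediumPart M ≤ 4 ^ K
  productTo-mediumPart≤ = begin
    productTo mediumPart M                                              ≡⟨ cong (productTo mediumPart) (sym (m+[n∸m]≡n K≤M)) ⟩
    productTo mediumPart (K + (M ∸ K))                                  ≡⟨ productTo-split mediumPart K (M ∸ K) ⟩
    productTo mediumPart K * productTo (λ i → mediumPart (K + i)) (M ∸ K) ≡⟨ cong₂ _*_ (productTo-cong K upTo-K) (productTo-one _ (M ∸ K) beyond-K) ⟩
    primorial K * 1                                                     ≡⟨ *-identityʳ _ ⟩
    primorial K                                                         ≤⟨ primorial≤4^ K ⟩
    4 ^ K                                                               ∎
    where
    open ≤-Reasoning
    K≤M : K ≤ M
    K≤M = m/n≤m M 3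
    upTo-K : ∀ i → 1 ≤ i → i ≤ K → mediumPart i ≡ primeOrOne i
    upTo-K i _ i≤K with prime? i | i ≤? K
    ... | yes _ | yes _   = refl
    ... | yes _ | no i≰K  = contradiction i≤K i≰K
    ... | no _  | _       = refl
    beyond-K : ∀ i → 1 ≤ i → i ≤ M ∸ K → mediumPart (K + i) ≡ 1
    beyond-K i 1≤i _ with prime? (K + i) | K + i ≤? K
    ... | yes _ | yes K+i≤K = contradiction K+i≤K (<⇒≱ (m<m+n K 1≤i))
    ... | yes _ | no _      = refl
    ... | no _  | _         = refl

  centralBinomial≤ : centralBinomial n ≤ productTo smallPart M * productTo mediumPart M * productTo largePart M
  centralBinomial≤ = ≤-trans (∣⇒≤ {{>-nonZero (productTo-pos part M part>0)}} centralBinomial∣productTo-part) (≤-reflexive (begin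
    productTo part M                                                    ≡⟨ productTo-* (λ i → smallPart i * mediumPart i) largePart M ⟩
    productTo (λ i → smallPart i * mediumPart i) M * productTo largePart M ≡⟨ cong (_* productTo largePart M) (productTo-* smallPart mediumPart M) ⟩
    productTo smallPart M * productTo mediumPart M * productTo largePart M ∎))
    where open ≡-Reasoning

  primeIn-largePart : ∀ N → 1 < productTo largePart N → ∃[ a ] (Prime a × n < a × a ≤ N)
  primeIn-largePart zero (s≤s ())
  primeIn-largePart (suc N) 1<∏ with prime? (suc N) | n <? suc N
  ... | yes pN | yes n<N = suc N , pN , n<N , ≤-refl
  ... | yes _  | no _    = map₂ (map₂ (map₂ m≤n⇒m≤1+n)) (primeIn-largePart N (subst (1 <_) (*-identityʳ _) 1<∏))
  ... | no _   | _       = map₂ (map₂ (map₂ m≤n⇒m≤1+n)) (primeIn-largePart N (subst (1 <_) (*-identityʳ _) 1<∏))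

  twoPrimesIn-largePart : ∀ N → N < productTo largePart N → 1 < productTo largePart N → TwoPrimesIn n N
  twoPrimesIn-largePart zero _ (s≤s ())
  twoPrimesIn-largePart (suc N) N<∏ 1<∏ with prime? (suc N) | n <? suc N
  ... | yes pN | yes n<N with primeIn-largePart N (m<m*n⇒1<n (subst (suc N <_) (*-comm _ (suc N)) N<∏))
  ...   | a , pa , n<a , a≤N = a , suc N , pa , pN , n<a , s≤s a≤N , ≤-refl
  twoPrimesIn-largePart (suc N) N<∏ 1<∏ | yes _ | no _ = map₂ (map₂ (map₂ (map₂ (map₂ (map₂ m≤n⇒m≤1+n)))))
    (twoPrimesIn-largePart N (<-trans (n<1+n N) (subst (suc N <_) (*-identityʳ _) N<∏)) (subst (1 <_) (*-identityʳ _) 1<∏))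
  twoPrimesIn-largePart (suc N) N<∏ 1<∏ | no _ | _ = map₂ (map₂ (map₂ (map₂ (map₂ (map₂ m≤n⇒m≤1+n)))))
    (twoPrimesIn-largePart N (<-trans (n<1+n N) (subst (suc N <_) (*-identityʳ _) N<∏)) (subst (1 <_) (*-identityʳ _) 1<∏))

∃4^k-bracket : ∀ x → 1 ≤ x → ∃[ k ] (2 ^ k * 2 ^ k ≤ x × x < 4 * (2 ^ k * 2 ^ k))
∃4^k-bracket (suc zero)    _ = 0 , ≤-refl , s≤s (s≤s z≤n)
∃4^k-bracket (suc (suc x)) _ with ∃4^k-bracket (suc x) (s≤s z≤n)
... | k , lo , hi with m≤n⇒m<n∨m≡n hi
...   | inj₁ 2+x<4s² = k , m≤n⇒m≤1+n lo , 2+x<4s²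
...   | inj₂ 2+x≡4s² = suc k , ≤-reflexive s′²≡2+x , subst (_< 4 * (s′ * s′)) s′²≡2+x s′²<4s′²
  where
  s′ = 2 ^ suc k
  s′²≡2+x : s′ * s′ ≡ suc (suc x)
  s′²≡2+x = trans (square-double (2 ^ k)) (sym 2+x≡4s²)
    where
    square-double : ∀ s → 2 * s * (2 * s) ≡ 4 * (s * s)
    square-double = solve-∀
  s′²<4s′² : s′ * s′ < 4 * (s′ * s′)
  s′²<4s′² = subst (s′ * s′ <_) (*-comm (s′ * s′) 4)
    (m<m*n (s′ * s′) 4 {{>-nonZero (*-mono-≤ (m^n>0 2 (suc k)) (m^n>0 2 (suc k)))}} (s≤s (s≤s z≤n)))

^-cancelʳ-≤ : ∀ m → 1 < m → ∀ {a b} → m ^ a ≤ m ^ b → a ≤ b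
^-cancelʳ-≤ m 1<m {a} {b} m^a≤m^b with a ≤? b
... | yes a≤b = a≤b
... | no  a≰b = contradiction m^a≤m^b (<⇒≱ (^-monoʳ-< m 1<m (≰⇒> a≰b)))

16*[1+k]≤2^k : ∀ k → 7 ≤ k → 16 * suc k ≤ 2 ^ k
16*[1+k]≤2^k k 7≤k = subst (λ k → 16 * suc k ≤ 2 ^ k) (m+[n∸m]≡n 7≤k) (from7 (k ∸ 7))
  where
  from7 : ∀ j → 16 * suc (7 + j) ≤ 2 ^ (7 + j)
  from7 zero    = ≤-refl
  from7 (suc j) = begin
    16 * suc (suc (7 + j))  ≤⟨ m≤m+n _ (16 * (7 + j)) ⟩
    16 * suc (suc (7 + j)) + 16 * (7 + j) ≡⟨ regroup (7 + j) ⟩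
    2 * (16 * suc (7 + j))  ≤⟨ *-monoʳ-≤ 2 (from7 j) ⟩
    2 ^ (7 + suc j)         ≡⟨ cong (2 ^_) (+-suc 7 j) ⟩
    2 ^ suc (7 + j)         ∎
    where
    open ≤-Reasoning
    regroup : ∀ m → 16 * suc (suc m) + 16 * m ≡ 2 * (16 * suc m)
    regroup = solve-∀

12*[1+k]*[1+s]<s*s : ∀ k s → 16 * suc k ≤ s → 12 * suc k * suc s < s * s
12*[1+k]*[1+s]<s*s k s 16[1+k]≤s = *-cancelˡ-< 16 _ _ (begin-strict
  16 * (12 * suc k * suc s) ≡⟨ regroup₁ k s ⟩
  12 * (16 * suc k) * suc s ≤⟨ *-monoˡ-≤ (suc s) (*-monoʳ-≤ 12 16[1+k]≤s) ⟩
  12 * s * suc s            ≡⟨ regroup₂ s ⟩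
  12 * s + 12 * (s * s)     <⟨ +-monoˡ-< (12 * (s * s)) 12s<4s² ⟩
  4 * s * s + 12 * (s * s)  ≡⟨ regroup₃ s ⟩
  16 * (s * s)              ∎)
  where
  open ≤-Reasoning
  regroup₁ : ∀ k s → 16 * (12 * suc k * suc s) ≡ 12 * (16 * suc k) * suc s
  regroup₁ = solve-∀
  regroup₂ : ∀ s → 12 * s * suc s ≡ 12 * s + 12 * (s * s)
  regroup₂ = solve-∀
  regroup₃ : ∀ s → 4 * s * s + 12 * (s * s) ≡ 16 * (s * s)
  regroup₃ = solve-∀
  regroup₄ : ∀ s → 12 * s + 4 * s ≡ 4 * 4 * s
  regroup₄ = solve-∀

  4≤s : 4 ≤ s
  4≤s = ≤-trans (m≤m+n 4 12) (≤-trans (m≤m*n 16 (suc k)) 16[1+k]≤s)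
  12s<4s² : 12 * s < 4 * s * s
  12s<4s² = begin-strict
    12 * s         <⟨ m<m+n (12 * s) (≤-trans (s≤s z≤n) (≤-trans 4≤s (m≤m+n s _))) ⟩
    12 * s + 4 * s ≡⟨ regroup₄ s ⟩
    4 * 4 * s      ≤⟨ *-monoˡ-≤ s (*-monoʳ-≤ 4 4≤s) ⟩
    4 * s * s      ∎

[1+M]*M^[r+1]*4^K≤2^ : ∀ M t r K → M < 2 ^ t → suc M * (M ^ r * 4 ^ K * M) ≤ 2 ^ (t + (t * r + 2 * K + t))
[1+M]*M^[r+1]*4^K≤2^ M t r K M<T = begin
  suc M * (M ^ r * 4 ^ K * M)                  ≤⟨ *-mono-≤ M<T (*-mono-≤ (*-monoˡ-≤ (4 ^ K) (^-monoˡ-≤ r M≤T)) M≤T) ⟩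
  T * (T ^ r * 4 ^ K * T)                      ≡⟨ cong₂ (λ a b → T * (a * b * T)) (^-*-assoc 2 t r) (^-*-assoc 2 2 K) ⟩
  T * (2 ^ (t * r) * 2 ^ (2 * K) * T)          ≡⟨ cong (λ z → T * (z * T)) (sym (^-distribˡ-+-* 2 (t * r) (2 * K))) ⟩
  T * (2 ^ (t * r + 2 * K) * T)                ≡⟨ cong (T *_) (sym (^-distribˡ-+-* 2 (t * r + 2 * K) t)) ⟩
  T * 2 ^ (t * r + 2 * K + t)                  ≡⟨ sym (^-distribˡ-+-* 2 t _) ⟩
  2 ^ (t + (t * r + 2 * K + t))                ∎
  where
  open ≤-Reasoning
  T = 2 ^ t
  M≤T : M ≤ T
  M≤T = <⇒≤ M<T

16384≤x<4^[k+1]⇒7≤k : ∀ {x} k → 16384 ≤ x → x < 4 * (2 ^ k * 2 ^ k) → 7 ≤ k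
16384≤x<4^[k+1]⇒7≤k k 16384≤x x<4s² with 7 ≤? k
... | yes 7≤k = 7≤k
... | no  7≰k = contradiction x<4s² (≤⇒≯ (≤-trans (*-monoʳ-≤ 4 (*-mono-≤ 2^k≤64 2^k≤64)) 16384≤x))
  where
  2^k≤64 : 2 ^ k ≤ 64
  2^k≤64 = ^-monoʳ-≤ 2 {k} {6} (<⇒≤pred (≰⇒> 7≰k))

-- The Erdős bound 4 ^ n ≤ (2n + 1) (2n) ^ (r + 1) 4 ^ (2n/3), with r = 2 · 2 ^ k > √(2n), fails once 2n ≥ 16384.
erdős-bound-fails : ∀ n k K → 16384 ≤ n + n → 2 ^ k * 2 ^ k ≤ n + n → n + n < 4 * (2 ^ k * 2 ^ k) → K * 3 ≤ n + n →
  ¬ (4 ^ n ≤ suc (n + n) * ((n + n) ^ (2 ^ k + 2 ^ k) * 4 ^ K * (n + n)))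
erdős-bound-fails n k K 16384≤M s²≤M M<4s² 3K≤M 4^n≤ =
  <⇒≱ (12*[1+k]*[1+s]<s*s k s (16*[1+k]≤2^k k 7≤k)) (≤-trans s²≤M (≤-trans M≤3t[r+2] (≤-reflexive (regroup₃ k s))))
  where
  open ≤-Reasoning
  M = n + n
  s = 2 ^ k
  r = s + s
  t = 2 + (k + k)
  E = t + (t * r + 2 * K + t)
  regroup₁ : ∀ n → n + n + 2 * (n + n) ≡ 3 * (2 * n)
  regroup₁ = solve-∀
  regroup₂ : ∀ t r K → 3 * (t + (t * r + 2 * K + t)) ≡ 3 * t * (r + 2) + 2 * (K * 3)
  regroup₂ = solve-∀
  regroup₃ : ∀ k s → 3 * (2 + (k + k)) * (s + s + 2) ≡ 12 * suc k * suc s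
  regroup₃ = solve-∀
  4s²≡2^t : 4 * (s * s) ≡ 2 ^ t
  4s²≡2^t = sym (trans (^-distribˡ-+-* 2 2 (k + k)) (cong (4 *_) (^-distribˡ-+-* 2 k k)))
  2n≤E : 2 * n ≤ E
  2n≤E = ^-cancelʳ-≤ 2 (s≤s (s≤s z≤n)) (begin
    2 ^ (2 * n)                        ≡⟨ sym (^-*-assoc 2 2 n) ⟩
    4 ^ n                              ≤⟨ 4^n≤ ⟩
    suc M * (M ^ r * 4 ^ K * M)        ≤⟨ [1+M]*M^[r+1]*4^K≤2^ M t r K (subst (M <_) 4s²≡2^t M<4s²) ⟩
    2 ^ E                              ∎)
  M≤3t[r+2] : M ≤ 3 * t * (r + 2)
  M≤3t[r+2] = +-cancelʳ-≤ (2 * M) M (3 * t * (r + 2)) (begin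
    M + 2 * M                       ≡⟨ regroup₁ n ⟩
    3 * (2 * n)                     ≤⟨ *-monoʳ-≤ 3 2n≤E ⟩
    3 * E                           ≡⟨ regroup₂ t r K ⟩
    3 * t * (r + 2) + 2 * (K * 3)   ≤⟨ +-monoʳ-≤ (3 * t * (r + 2)) (*-monoʳ-≤ 2 3K≤M) ⟩
    3 * t * (r + 2) + 2 * M         ∎)
  7≤k : 7 ≤ k
  7≤k = 16384≤x<4^[k+1]⇒7≤k k 16384≤M M<4s²

module _ {n} (8192≤n : 8192 ≤ n) where
  private
    M = n + n
    1≤M : 1 ≤ M
    1≤M = ≤-trans {1} {8192} (s≤s z≤n) (≤-trans 8192≤n (m≤m+n n n))
  open CentralBinomialFactors (≤-trans {3} {8192} (s≤s (s≤s (s≤s z≤n))) 8192≤n)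

  twoPrimesIn-doubling : TwoPrimesIn n (n + n)
  twoPrimesIn-doubling with M <? productTo largePart M
  ... | yes M<∏ = twoPrimesIn-largePart M M<∏ (≤-<-trans 1≤M M<∏)
  ... | no  M≮∏ with ∃4^k-bracket M 1≤M
  ...   | k , s²≤M , M<4s² =
    contradiction 4^n≤ (erdős-bound-fails n k K (+-mono-≤ {8192} {n} {8192} {n} 8192≤n 8192≤n) s²≤M M<4s² (m/n*n≤m M 3))
    where
    K = M / 3
    r = 2 ^ k + 2 ^ k
    M<r² : M < r * r
    M<r² = subst (M <_) (4s²≡[2s]² (2 ^ k)) M<4s²
      where
      4s²≡[2s]² : ∀ s → 4 * (s * s) ≡ (s + s) * (s + s)
      4s²≡[2s]² = solve-∀
    4^n≤ : 4 ^ n ≤ suc M * (M ^ r * 4 ^ K * M)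
    4^n≤ = begin
      4 ^ n                                 ≤⟨ 4^n≤[2n+1]*centralBinomial n ⟩
      suc M * centralBinomial n             ≤⟨ *-monoʳ-≤ (suc M) centralBinomial≤ ⟩
      suc M * (productTo smallPart M * productTo mediumPart M * productTo largePart M)
                                            ≤⟨ *-monoʳ-≤ (suc M) (*-mono-≤ (*-mono-≤ (productTo-smallPart≤ r M<r²) productTo-mediumPart≤) (≮⇒≥ M≮∏)) ⟩
      suc M * (M ^ r * 4 ^ K * M)           ∎
      where open ≤-Reasoning

-- The inequality says 1/a + 1/b + 1/ab > 1/n, so that a prime pair above a deficient
-- number can turn it abundant in exactly two steps.
PrimePairAbove : ℕ → Set
PrimePairAbove n = ∃[ a ] ∃[ b ] (Prime a × Prime b × n < a × a < b × a * b < n * suc (a + b))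

PrimePairAbove-mono : ∀ {m n} → m ≤ n → ∀ a b → Prime a → Prime b → n < a → a < b →
  a * b < m * suc (a + b) → PrimePairAbove n
PrimePairAbove-mono m≤n a b pa pb n<a a<b ab<m[1+a+b] =
  a , b , pa , pb , n<a , a<b , <-≤-trans ab<m[1+a+b] (*-monoˡ-≤ (suc (a + b)) m≤n)

TwoPrimesIn-doubling⇒PrimePairAbove : ∀ n → 0 < n → TwoPrimesIn n (n + n) → PrimePairAbove n
TwoPrimesIn-doubling⇒PrimePairAbove n n>0 (a , b , pa , pb , n<a , a<b , b≤2n) = a , b , pa , pb , n<a , a<b , (begin-strict
  a * b                 ≤⟨ *-monoʳ-≤ a b≤2n ⟩
  a * (n + n)           ≡⟨ regroup₁ a n ⟩
  n * a + n * a         ≤⟨ +-monoʳ-≤ (n * a) (*-monoʳ-≤ n (<⇒≤ a<b)) ⟩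
  n * a + n * b         <⟨ m<n+m (n * a + n * b) n>0 ⟩
  n + (n * a + n * b)   ≡⟨ regroup₂ n a b ⟩
  n * suc (a + b)       ∎)
  where
  open ≤-Reasoning
  regroup₁ : ∀ a n → a * (n + n) ≡ n * a + n * a
  regroup₁ = solve-∀
  regroup₂ : ∀ n a b → n + (n * a + n * b) ≡ n * suc (a + b)
  regroup₂ = solve-∀

-- Windows x a (b ∷ c ∷ …) says that (a , b) is a prime pair above every n in [x , a), (b , c) above
-- every n in [a , b), and so on.
Windows : ℕ → ℕ → List ℕ → Set
Windows x a []       = ⊤
Windows x a (b ∷ bs) = (Prime a × Prime b × a < b × a * b < x * suc (a + b)) × Windows a b bs

windows? : ∀ x a bs → Dec (Windows x a bs)
windows? x a []       = yes tt
windows? x a (b ∷ bs) =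
  (prime? a ×-dec (prime? b ×-dec ((a <? b) ×-dec (a * b <? x * suc (a + b))))) ×-dec windows? a b bs

windowsEnd : ℕ → ℕ → List ℕ → ℕ
windowsEnd x a []       = x
windowsEnd x a (b ∷ bs) = windowsEnd a b bs

windows-cover : ∀ {x a} bs → Windows x a bs → ∀ n → x ≤ n → n < windowsEnd x a bs → PrimePairAbove n
windows-cover []       _ n x≤n n<x = contradiction x≤n (<⇒≱ n<x)
windows-cover {x} {a} (b ∷ bs) ((pa , pb , a<b , ab<) , rest) n x≤n n<end with n <? a
... | yes n<a = PrimePairAbove-mono x≤n a b pa pb n<a a<b ab<
... | no  n≮a = windows-cover bs rest n (≮⇒≥ n≮a) n<end

smallPrimes : List ℕ
smallPrimes = 5 ∷ 7 ∷ 11 ∷ 19 ∷ 23 ∷ 43 ∷ 47 ∷ 89 ∷ 97 ∷ 191 ∷ 197 ∷ 389 ∷ 397 ∷ 787 ∷ 797 ∷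
              1583 ∷ 1601 ∷ 3191 ∷ 3209 ∷ 6397 ∷ 6427 ∷ 12841 ∷ 12853 ∷ []

smallWindows : Windows 2 3 smallPrimes
smallWindows = from-yes (windows? 2 3 smallPrimes)

primePairAbove : ∀ n → 2 ≤ n → PrimePairAbove n
primePairAbove n 2≤n with n <? 8192
... | yes n<8192 = windows-cover smallPrimes smallWindows n 2≤n (<-trans n<8192 (<ᵇ⇒< 8192 12841 tt))
... | no  n≮8192 = TwoPrimesIn-doubling⇒PrimePairAbove n (<-trans (s≤s z≤n) 2≤n) (twoPrimesIn-doubling (≮⇒≥ n≮8192))

-- Completing a deficient product

abundant-*-smallerPrime : ∀ {u p q} → 0 < u → Prime p → Prime q → q ≤ p → ¬ q ∣ u →
  Abundant (u * p) → Abundant (u * q)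
abundant-*-smallerPrime {u} {p} {q} u>0 pp pq q≤p q∤u 2up<σ[up] =
  subst (2 * (u * q) <_) (sym (σ-*-prime pq u u>0 q∤u)) (*-cancelˡ-< p _ _ (begin-strict
    p * (2 * (u * q))  ≡⟨ regroup₁ p u q ⟩
    q * (2 * (u * p))  <⟨ *-monoʳ-< q {{prime⇒nonZero pq}} 2up<σ[up] ⟩
    q * σ (u * p)      ≤⟨ *-monoʳ-≤ q (σ-*-prime-≤ pp u u>0) ⟩
    q * (σ u * suc p)  ≡⟨ regroup₂ q (σ u) p ⟩
    σ u * (q * suc p)  ≤⟨ *-monoʳ-≤ (σ u) q[1+p]≤p[1+q] ⟩
    σ u * (p * suc q)  ≡⟨ regroup₂ (σ u) p q ⟩
    p * (σ u * suc q)  ∎))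
  where
  open ≤-Reasoning
  regroup₁ : ∀ a b c → a * (2 * (b * c)) ≡ c * (2 * (b * a))
  regroup₁ = solve-∀
  regroup₂ : ∀ a b c → a * (b * suc c) ≡ b * (a * suc c)
  regroup₂ = solve-∀
  q[1+p]≤p[1+q] : q * suc p ≤ p * suc q
  q[1+p]≤p[1+q] = begin
    q * suc p   ≡⟨ *-suc q p ⟩
    q + q * p   ≤⟨ +-monoˡ-≤ (q * p) q≤p ⟩
    p + q * p   ≡⟨ cong (p +_) (*-comm q p) ⟩
    p + p * q   ≡⟨ sym (*-suc p q) ⟩
    p * suc q   ∎

-- N n would be non-deficient if n were a new prime factor of N.
NonDeficientWith : ℕ → ℕ → Set
NonDeficientWith n N = 2 * N * n ≤ σ N * suc n

module _ {N t} (σN+t≡2N : σ N + t ≡ 2 * N) where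
  NonDeficientWith⇒*≤σ : ∀ {n} → NonDeficientWith n N → t * n ≤ σ N
  NonDeficientWith⇒*≤σ {n} nonDeficientWith = +-cancelˡ-≤ (σ N * n) _ _ (begin
    σ N * n + t * n ≡⟨ sym (*-distribʳ-+ n (σ N) t) ⟩
    (σ N + t) * n   ≡⟨ cong (_* n) σN+t≡2N ⟩
    2 * N * n       ≤⟨ nonDeficientWith ⟩
    σ N * suc n     ≡⟨ trans (*-suc (σ N) n) (+-comm (σ N) _) ⟩
    σ N * n + σ N   ∎)
    where open ≤-Reasoning

  module _ (N>0 : 0 < N) where
    *-prime-deficient : ∀ {a} → Prime a → ¬ a ∣ N → σ N < t * a → Deficient (N * a)
    *-prime-deficient {a} pa a∤N σN<ta = begin-strict
      σ (N * a)       ≡⟨ σ-*-prime pa N N>0 a∤N ⟩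
      σ N * suc a     ≡⟨ *-suc (σ N) a ⟩
      σ N + σ N * a   <⟨ +-monoˡ-< (σ N * a) σN<ta ⟩
      t * a + σ N * a ≡⟨ sym (*-distribʳ-+ a t (σ N)) ⟩
      (t + σ N) * a   ≡⟨ cong (_* a) (trans (+-comm t (σ N)) σN+t≡2N) ⟩
      2 * N * a       ≡⟨ *-assoc 2 N a ⟩
      2 * (N * a)     ∎
      where open ≤-Reasoning

    *-primes-abundant : ∀ {a b} → Prime a → Prime b → ¬ a ∣ N → ¬ b ∣ N * a →
      t * (a * b) < σ N * suc (a + b) → Abundant (N * a * b)
    *-primes-abundant {a} {b} pa pb a∤N b∤Na tab<σN[1+a+b] = begin-strict
      2 * (N * a * b)                   ≡⟨ regroup₁ N a b ⟩
      2 * N * (a * b)                   ≡⟨ cong (_* (a * b)) (sym σN+t≡2N) ⟩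
      (σ N + t) * (a * b)               ≡⟨ *-distribʳ-+ (a * b) (σ N) t ⟩
      σ N * (a * b) + t * (a * b)       <⟨ +-monoʳ-< (σ N * (a * b)) tab<σN[1+a+b] ⟩
      σ N * (a * b) + σ N * suc (a + b) ≡⟨ regroup₂ (σ N) a b ⟩
      σ N * suc a * suc b               ≡⟨ cong (_* suc b) (sym (σ-*-prime pa N N>0 a∤N)) ⟩
      σ (N * a) * suc b                 ≡⟨ sym (σ-*-prime pb (N * a) (*-mono-≤ N>0 (prime>0 pa)) b∤Na) ⟩
      σ (N * a * b)                     ∎
      where
      open ≤-Reasoning
      regroup₁ : ∀ x y z → 2 * (x * y * z) ≡ 2 * x * (y * z)
      regroup₁ = solve-∀
      regroup₂ : ∀ x y z → x * (y * z) + x * suc (y + z) ≡ x * suc y * suc z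
      regroup₂ = solve-∀

    *-prime-nonDeficientWith : ∀ {a} → Prime a → ¬ a ∣ N → t * (a * a) ≤ σ N * suc (a + a) →
      2 * (N * a) * a ≤ σ (N * a) * suc a
    *-prime-nonDeficientWith {a} pa a∤N ta²≤σN[1+2a] = begin
      2 * (N * a) * a                   ≡⟨ regroup₁ N a ⟩
      2 * N * (a * a)                   ≡⟨ cong (_* (a * a)) (sym σN+t≡2N) ⟩
      (σ N + t) * (a * a)               ≡⟨ *-distribʳ-+ (a * a) (σ N) t ⟩
      σ N * (a * a) + t * (a * a)       ≤⟨ +-monoʳ-≤ (σ N * (a * a)) ta²≤σN[1+2a] ⟩
      σ N * (a * a) + σ N * suc (a + a) ≡⟨ regroup₂ (σ N) a ⟩
      σ N * suc a * suc a               ≡⟨ cong (_* suc a) (sym (σ-*-prime pa N N>0 a∤N)) ⟩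
      σ (N * a) * suc a                 ∎
      where
      open ≤-Reasoning
      regroup₁ : ∀ x y → 2 * (x * y) * y ≡ 2 * x * (y * y)
      regroup₁ = solve-∀
      regroup₂ : ∀ x y → x * (y * y) + x * suc (y + y) ≡ x * suc y * suc y
      regroup₂ = solve-∀

module _ (S t : ℕ) .{{_ : NonZero t}} where
  /-<⇒<* : ∀ a → S / t < a → S < t * a
  /-<⇒<* a S/t<a = begin-strict
    S                 <⟨ m<[1+m/n]*n S t ⟩
    suc (S / t) * t   ≤⟨ *-monoˡ-≤ t S/t<a ⟩
    a * t             ≡⟨ *-comm a t ⟩
    t * a             ∎
    where open ≤-Reasoning

  *<[/]*⇒*<* : ∀ x y → x < (S / t) * y → t * x < S * y
  *<[/]*⇒*<* x y x<[S/t]y = begin-strict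
    t * x             <⟨ *-monoʳ-< t x<[S/t]y ⟩
    t * (S / t * y)   ≡⟨ sym (*-assoc t (S / t) y) ⟩
    t * (S / t) * y   ≤⟨ *-monoˡ-≤ y (subst (_≤ S) (*-comm (S / t) t) (m/n*n≤m S t)) ⟩
    S * y             ∎
    where open ≤-Reasoning

  *≤⇒≤/ : ∀ n → t * n ≤ S → n ≤ S / t
  *≤⇒≤/ n tn≤S = subst (_≤ S / t) (m*n/n≡m n t) (/-monoˡ-≤ t (subst (_≤ S) (*-comm t n) tn≤S))

pair⇒square : ∀ S t a b → 0 < a → a < b → t * (a * b) < S * suc (a + b) → t * (a * a) < S * suc (a + a)
pair⇒square S t a b a>0 a<b tab<S[1+a+b] = *-cancelʳ-< b _ _ (begin-strict
  t * (a * a) * b         ≡⟨ regroup₁ t a b ⟩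
  a * (t * (a * b))       <⟨ *-monoʳ-< a {{>-nonZero a>0}} tab<S[1+a+b] ⟩
  a * (S * suc (a + b))   ≡⟨ regroup₂ a S b ⟩
  S * (a * suc (a + b))   ≤⟨ *-monoʳ-≤ S a[1+a+b]≤[1+2a]b ⟩
  S * (suc (a + a) * b)   ≡⟨ sym (*-assoc S _ b) ⟩
  S * suc (a + a) * b     ∎)
  where
  open ≤-Reasoning
  regroup₁ : ∀ x y z → x * (y * y) * z ≡ y * (x * (y * z))
  regroup₁ = solve-∀
  regroup₂ : ∀ x y z → x * (y * suc (x + z)) ≡ y * (x * suc (x + z))
  regroup₂ = solve-∀
  a[1+a+b]≤[1+2a]b : a * suc (a + b) ≤ suc (a + a) * b
  a[1+a+b]≤[1+2a]b = begin
    a * suc (a + b)      ≡⟨ regroup₃ a b ⟩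
    a * suc a + a * b    ≤⟨ +-monoˡ-≤ (a * b) (*-monoˡ-≤ (suc a) (<⇒≤ a<b)) ⟩
    b * suc a + a * b    ≡⟨ regroup₄ a b ⟩
    suc (a + a) * b      ∎
    where
    regroup₃ : ∀ x y → x * suc (x + y) ≡ x * suc x + x * y
    regroup₃ = solve-∀
    regroup₄ : ∀ x y → y * suc x + x * y ≡ suc (x + x) * y
    regroup₄ = solve-∀

Smooth : ℕ → ℕ → Set
Smooth n N = ∀ p → Prime p → p ∣ N → p ≤ n

Smooth-mono : ∀ {m n N} → m ≤ n → Smooth m N → Smooth n N
Smooth-mono m≤n smooth p pp p∣N = ≤-trans (smooth p pp p∣N) m≤n

Smooth-* : ∀ {n N a} → Prime a → n ≤ a → Smooth n N → Smooth a (N * a)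
Smooth-* {N = N} {a} pa n≤a smooth p pp p∣Na with euclidsLemma N a pp p∣Na
... | inj₁ p∣N = ≤-trans (smooth p pp p∣N) n≤a
... | inj₂ p∣a = ≤-reflexive (prime∣prime⇒≡ pp pa p∣a)

Smooth⇒∤ : ∀ {n N a} → Smooth n N → Prime a → n < a → ¬ a ∣ N
Smooth⇒∤ smooth pa n<a a∣N = <⇒≱ n<a (smooth _ pa a∣N)

Completion : (ℕ → ℕ → Set) → ℕ → ℕ → ℕ → Set
Completion _R_ N c L = ∃[ qs ] (length qs ≡ L × All Prime qs × Linked _R_ (c ∷ qs)
  × Abundant (N * product qs) × (∀ i → i < L → Deficient (N * product (take i qs))))

completion-[_] : ∀ {R : ℕ → ℕ → Set} {N c b} → Prime b → R c b → Deficient N → Abundant (N * b) → Completion R N c 1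
completion-[_] {N = N} {b = b} pb cRb defN abNb =
  b ∷ [] , refl , pb ∷ [] , cRb ∷ [-] , subst Abundant (cong (N *_) (sym (*-identityʳ b))) abNb , deficientPrefix
  where
  deficientPrefix : ∀ i → i < 1 → Deficient (N * product (take i (b ∷ [])))
  deficientPrefix zero _ = subst Deficient (sym (*-identityʳ N)) defN
  deficientPrefix (suc _) (s≤s ())

completion-∷ : ∀ {R : ℕ → ℕ → Set} {N c a L} → Prime a → R c a → Deficient N →
  Completion R (N * a) a L → Completion R N c (suc L)
completion-∷ {N = N} {a = a} pa cRa defN (qs , length≡L , primes , linked , abundant , deficientPrefix′) =
  a ∷ qs , cong suc length≡L , pa ∷ primes , cRa ∷ linked , subst Abundant (*-assoc N a (product qs)) abundant , deficientPrefix
  where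
  deficientPrefix : ∀ i → i < suc _ → Deficient (N * product (take i (a ∷ qs)))
  deficientPrefix zero    _         = subst Deficient (sym (*-identityʳ N)) defN
  deficientPrefix (suc i) (s≤s i<L) = subst Deficient (*-assoc N a (product (take i qs))) (deficientPrefix′ i i<L)

completion-weaken : ∀ {N c r L} → c ≤ r → Completion _<_ N r L → Completion _≤_ N c L
completion-weaken c≤r (qs , length≡L , primes , linked , abundant , deficientPrefix) =
  qs , length≡L , primes , weaken c≤r linked , abundant , deficientPrefix
  where
  weaken : ∀ {c r qs} → c ≤ r → Linked _<_ (r ∷ qs) → Linked _≤_ (c ∷ qs)
  weaken c≤r [-]             = [-]
  weaken c≤r (r<q ∷ linked)  = ≤-trans c≤r (<⇒≤ r<q) ∷ Linked-map <⇒≤ linked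

-- With t = 2N − σ N, the primes a < b of a pair above σ N / t satisfy σ N < t a (so N a stays
-- deficient) and t a b < σ N (1 + a + b) (so N a b is abundant).
escape : ∀ ℓ {N n} → 0 < N → Deficient N → NonDeficientWith n N → Smooth n N → 2 ≤ n → Completion _<_ N n (2 + ℓ)
escape ℓ {N} {n} N>0 defN nonDeficientWith smooth 2≤n = complete ℓ (primePairAbove (σ N / t) 2≤σN/t)
  where
  t = 2 * N ∸ σ N
  instance
    t≢0 : NonZero t
    t≢0 = >-nonZero (m<n⇒0<n∸m defN)
  σN+t≡2N : σ N + t ≡ 2 * N
  σN+t≡2N = m+[n∸m]≡n (<⇒≤ defN)
  n≤σN/t : n ≤ σ N / t
  n≤σN/t = *≤⇒≤/ (σ N) t n (NonDeficientWith⇒*≤σ {N} σN+t≡2N nonDeficientWith)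
  2≤σN/t : 2 ≤ σ N / t
  2≤σN/t = ≤-trans 2≤n n≤σN/t

  complete : ∀ ℓ → PrimePairAbove (σ N / t) → Completion _<_ N n (2 + ℓ)
  complete ℓ (a , b , pa , pb , σN/t<a , a<b , ab<) = completion-∷ {N = N} pa n<a defN (completeFrom ℓ)
    where
    n<a : n < a
    n<a = ≤-<-trans n≤σN/t σN/t<a
    a∤N : ¬ a ∣ N
    a∤N = Smooth⇒∤ smooth pa n<a
    b∤Na : ¬ b ∣ N * a
    b∤Na b∣Na = [ Smooth⇒∤ smooth pb (<-trans n<a a<b) , (λ b∣a → <⇒≱ a<b (∣⇒≤ {{prime⇒nonZero pa}} b∣a)) ]′
                  (euclidsLemma N a pb b∣Na)
    Na>0 : 0 < N * a
    Na>0 = *-mono-≤ N>0 (prime>0 pa)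
    tab<σN[1+a+b] : t * (a * b) < σ N * suc (a + b)
    tab<σN[1+a+b] = *<[/]*⇒*<* (σ N) t (a * b) (suc (a + b)) ab<
    defNa : Deficient (N * a)
    defNa = *-prime-deficient {N} σN+t≡2N N>0 pa a∤N (/-<⇒<* (σ N) t a σN/t<a)
    abNab : Abundant (N * a * b)
    abNab = *-primes-abundant {N} σN+t≡2N N>0 pa pb a∤N b∤Na tab<σN[1+a+b]
    nonDeficientWithNa : NonDeficientWith a (N * a)
    nonDeficientWithNa = *-prime-nonDeficientWith {N} σN+t≡2N N>0 pa a∤N (<⇒≤ (pair⇒square (σ N) t a b (prime>0 pa) a<b tab<σN[1+a+b]))
    completeFrom : ∀ ℓ → Completion _<_ (N * a) a (suc ℓ)
    completeFrom zero     = completion-[_] {N = N * a} pb a<b defNa abNab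
    completeFrom (suc ℓ′) = escape ℓ′ Na>0 defNa nonDeficientWithNa (Smooth-* pa (<⇒≤ n<a) smooth) (prime≥2 pa)

-- Append the primes of R one at a time while the product stays deficient; at the first prime r
-- that would make it non-deficient, switch to escape, which only needs NonDeficientWith r.
greedy : ∀ R {N c} → 0 < N → Deficient N → Smooth c N → All Prime R → Linked _≤_ (c ∷ R) → ¬ R ≡ [] →
  Abundant (N * product R) → Completion _≤_ N c (length R)
greedy []           _   _    _      _         _               R≢[] _  = contradiction refl R≢[]
greedy (r ∷ [])     {N} _   defN _      (pr ∷ []) (c≤r ∷ [-])     _    ab =
  completion-[_] {N = N} pr c≤r defN (subst Abundant (cong (N *_) (*-identityʳ r)) ab)
greedy (r ∷ r′ ∷ R) {N} N>0 defN smooth (pr ∷ prs) (c≤r ∷ linked) _ ab with σ (N * r) <? 2 * (N * r)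
... | yes defNr  = completion-∷ {N = N} pr c≤r defN
  (greedy (r′ ∷ R) (*-mono-≤ N>0 (prime>0 pr)) defNr (Smooth-* pr c≤r smooth) prs linked (λ ())
          (subst Abundant (sym (*-assoc N r (product (r′ ∷ R)))) ab))
... | no  ¬defNr = completion-weaken {N = N} c≤r (escape (length R) {N} N>0 defN nonDeficientWith (Smooth-mono c≤r smooth) (prime≥2 pr))
  where
  nonDeficientWith : NonDeficientWith r N
  nonDeficientWith = begin
    2 * N * r      ≡⟨ *-assoc 2 N r ⟩
    2 * (N * r)    ≤⟨ ≮⇒≥ ¬defNr ⟩
    σ (N * r)      ≤⟨ σ-*-prime-≤ pr N N>0 ⟩
    σ N * suc r    ∎
    where open ≤-Reasoning

All-Prime⇒Smooth : ∀ {c xs} → All Prime xs → All (_≤ c) xs → Smooth c (product xs)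
All-Prime⇒Smooth primes xs≤c p pp p∣∏ = All-lookup xs≤c (factorisationHasAllPrimeFactors pp p∣∏ primes)

prime∤product : ∀ {q xs} → Prime q → All Prime xs → All (_≢ q) xs → ¬ q ∣ product xs
prime∤product pq primes xs≢q q∣∏ = All-lookup xs≢q (factorisationHasAllPrimeFactors pq q∣∏ primes) refl

product-++-∷ : ∀ xs y ys → product (xs ++ y ∷ ys) ≡ product (xs ++ ys) * y
product-++-∷ []       y ys = *-comm y (product ys)
product-++-∷ (x ∷ xs) y ys = trans (cong (x *_) (product-++-∷ xs y ys)) (sym (*-assoc x _ y))

product-++-∷-split : ∀ xs y ys → product (xs ++ y ∷ ys) ≡ product (xs ++ y ∷ []) * product ys
product-++-∷-split xs y ys = trans (cong product (sym (++-assoc xs (y ∷ []) ys))) (product-++ (xs ++ y ∷ []) ys)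

Linked-++⁻ʳ : ∀ {R : ℕ → ℕ → Set} xs {ys} → Linked R (xs ++ ys) → Linked R ys
Linked-++⁻ʳ []       linked = linked
Linked-++⁻ʳ (x ∷ xs) linked = Linked-++⁻ʳ xs (Linked-tail linked)

Linked-≤⇒≤lastOr1 : ∀ xs {ys} → Linked _≤_ (xs ++ ys) → All (_≤ lastOr1 xs) xs
Linked-≤⇒≤lastOr1 []           _                 = []
Linked-≤⇒≤lastOr1 (x ∷ [])     _                 = ≤-refl ∷ []
Linked-≤⇒≤lastOr1 (x ∷ y ∷ xs) (x≤y ∷ linked) with Linked-≤⇒≤lastOr1 (y ∷ xs) linked
... | y≤last ∷ xs≤last = ≤-trans x≤y y≤last ∷ y≤last ∷ xs≤last

Linked-≤⇒≤head : ∀ {x xs} → Linked _≤_ (x ∷ xs) → All (x ≤_) xs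
Linked-≤⇒≤head [-]            = []
Linked-≤⇒≤head (x≤y ∷ linked) = Linked⇒All ≤-trans x≤y linked

Linked-≤-lowerHead : ∀ {x y xs} → x ≤ y → Linked _≤_ (y ∷ xs) → Linked _≤_ (x ∷ xs)
Linked-≤-lowerHead x≤y [-]            = [-]
Linked-≤-lowerHead x≤y (y≤z ∷ linked) = ≤-trans x≤y y≤z ∷ linked

theorem3p7 :
  (pre : List ℕ) (pj : ℕ) (post : List ℕ) →
  All Prime (pre ++ pj ∷ post) →
  Linked _≤_ (pre ++ pj ∷ post) →
  PrimitiveAbundant (product (pre ++ pj ∷ post)) →
  ¬ (post ≡ []) →
  (q : ℕ) → Prime q → lastOr1 pre < q → q < pj →
  Deficient (product (pre ++ q ∷ [])) →
  ∃[ qs ] (length qs ≡ length post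
    × All Prime qs
    × Linked _≤_ (q ∷ qs)
    × Abundant (product (pre ++ q ∷ qs))
    × (∀ i → i < length qs → Deficient (product (pre ++ q ∷ take i qs))))
theorem3p7 pre pj post primes sorted (abundant , _) post≢[] q pq lastPre<q q<pj deficient
  with greedy post N>0 deficient smooth postPrimes (Linked-≤-lowerHead (<⇒≤ q<pj) sortedFromPj) post≢[] abundantWithPost
  where
  prePrimes  = ++⁻ˡ pre primes
  postPrimes = All-tail (++⁻ʳ pre primes)
  sortedFromPj = Linked-++⁻ʳ pre sorted
  pre<q : All (_< q) pre
  pre<q = All-map (λ x≤last → ≤-<-trans x≤last lastPre<q) (Linked-≤⇒≤lastOr1 pre sorted)
  N>0 : 0 < product (pre ++ q ∷ [])
  N>0 = productOfPrimes≥1 (++⁺ prePrimes (pq ∷ []))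
  smooth : Smooth q (product (pre ++ q ∷ []))
  smooth = All-Prime⇒Smooth (++⁺ prePrimes (pq ∷ [])) (++⁺ (All-map <⇒≤ pre<q) (≤-refl ∷ []))
  q∤rest : ¬ q ∣ product (pre ++ post)
  q∤rest = prime∤product pq (++⁺ prePrimes postPrimes)
    (++⁺ (All-map <⇒≢ pre<q) (All-map (λ pj≤x → ≢-sym (<⇒≢ (<-≤-trans q<pj pj≤x))) (Linked-≤⇒≤head sortedFromPj)))
  abundantWithPost : Abundant (product (pre ++ q ∷ []) * product post)
  abundantWithPost = subst Abundant (trans (sym (product-++-∷ pre q post)) (product-++-∷-split pre q post))
    (abundant-*-smallerPrime (productOfPrimes≥1 (++⁺ prePrimes postPrimes)) (All-head (++⁻ʳ pre primes)) pq (<⇒≤ q<pj) q∤rest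
      (subst Abundant (product-++-∷ pre pj post) abundant))
... | qs , length≡ , qsPrimes , sortedQs , abundantQs , deficientPrefix =
  qs , length≡ , qsPrimes , sortedQs , subst Abundant (sym (product-++-∷-split pre q qs)) abundantQs ,
  λ i i<length → subst Deficient (sym (product-++-∷-split pre q (take i qs))) (deficientPrefix i (subst (i <_) length≡ i<length))
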